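{- For a finite rooted labelled tree $T$ with root $r$, the polynomial $C_r(x)$ (defined in the context) is a complete invariant: for any two finite rooted labelled trees $T$ (root $r$) and $T'$ (root $r'$), $C_r(x) = C_{r'}(x)$ if and only if there is an isomorphism of rooted labelled trees from $T$ to $T'$, i.e., a graph isomorphism mapping $r$ to $r'$ and preserving the labels of all vertices.
   Context: For $i\ge 1$, $p_i$ denotes the $i$-th prime number. A rooted labelled tree is a rooted tree $T$ together with a label $\ell(v)\in\mathbb{N}_{\ge1}$ for each vertex $v$. For a vertex $v$, $T_v$ is the subtree rooted at $v$ (consisting of $v$ and its descendants) and $n_v$ is its number of vertices. Define inductively: $C_v(x) = x + p_{\ell(v)}$ if $v$ is a leaf, and $C_v(x) = x^{n_v} + p_{\ell(v)}\, x \prod_{u \text{ child of } v} C_u(x) + p_{\ell(v)}$ if $v$ is an internal vertex. -}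

module Defs where

open import Data.Nat using (ℕ; zero; suc; _+_; _*_; _∸_; _≤_; _!)
open import Data.Nat.Primality using (prime?)

open import Data.Fin using (Fin; zero; suc)
open import Data.List using (List; []; _∷_; length; lookup; map; replicate; _++_)
open import Data.Product using (Σ; _×_)
open import Data.Sum using (_⊎_)
open import Relation.Nullary using (does)
open import Data.Bool using (if_then_else_)
open import Relation.Binary.PropositionalEquality using (_≡_)
open import Function.Bundles using (_↔_; _⇔_; Inverse)

-- The i-th prime p_i (i ≥ 1):  p 1 = 2, p 2 = 3, p 3 = 5, ...

-- search fuel c : first prime among c, c+1, ..., c+fuel-1 (or c+fuel if none)
search : ℕ → ℕ → ℕ
search zero    c = c
search (suc f) c = if does (prime? c) then c else search f (suc c)

-- least prime strictly greater than n (there is one in (n, n!+1])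
nextPrime : ℕ → ℕ
nextPrime n = search (n !) (suc n)

-- nthPrime0 i = p_{i+1}
nthPrime0 : ℕ → ℕ
nthPrime0 zero    = 2
nthPrime0 (suc i) = nextPrime (nthPrime0 i)

p : ℕ → ℕ
p i = nthPrime0 (i ∸ 1)

-- Polynomials with natural-number coefficients, as little-endian
-- coefficient lists; equality is equality of all coefficients.

Poly : Set
Poly = List ℕ

infixl 6 _+P_
infixl 7 _*P_

_+P_ : Poly → Poly → Poly
[]      +P q       = q
(a ∷ f) +P []      = a ∷ f
(a ∷ f) +P (b ∷ g) = (a + b) ∷ (f +P g)

scaleP : ℕ → Poly → Poly
scaleP a f = map (a *_) f

_*P_ : Poly → Poly → Poly
[]      *P g = []
(a ∷ f) *P g = scaleP a g +P (0 ∷ (f *P g))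

constP : ℕ → Poly
constP c = c ∷ []

X : Poly
X = 0 ∷ 1 ∷ []

X^ : ℕ → Poly
X^ n = replicate n 0 ++ (1 ∷ [])

coeff : Poly → ℕ → ℕ
coeff []      _       = 0
coeff (a ∷ f) zero    = a
coeff (a ∷ f) (suc k) = coeff f k

_≈P_ : Poly → Poly → Set
f ≈P g = ∀ k → coeff f k ≡ coeff g k

-- Finite rooted labelled trees (labels ≥ 1).  A tree is given by its
-- root label and the list of subtrees rooted at the children.

data Tree : Set where
  node : (ℓ : ℕ) → 1 ≤ ℓ → List Tree → Tree

label : Tree → ℕ
label (node ℓ _ _) = ℓ

mutual
  size : Tree → ℕ
  size (node _ _ ts) = suc (sizes ts)

  sizes : List Tree → ℕ
  sizes []       = 0
  sizes (t ∷ ts) = size t + sizes ts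

mutual
  C : Tree → Poly
  C (node ℓ _ [])         = X +P constP (p ℓ)
  C (node ℓ h (t ∷ ts))   =
    X^ (size (node ℓ h (t ∷ ts)))
      +P constP (p ℓ) *P X *P prodC (t ∷ ts)
      +P constP (p ℓ)

  prodC : List Tree → Poly
  prodC []       = constP 1
  prodC (t ∷ ts) = C t *P prodC ts

-- Vertices of a tree (positions), the labelling, and the edges.

data Pos : Tree → Set where
  here  : ∀ {t} → Pos t
  child : ∀ {ℓ h ts} (i : Fin (length ts)) → Pos (lookup ts i) → Pos (node ℓ h ts)

labelAt : ∀ {t} → Pos t → ℕ
labelAt {t} here      = label t
labelAt (child i v)   = labelAt v

-- u ⋖ v : v is a child of u
data _⋖_ : ∀ {t} → Pos t → Pos t → Set where
  top  : ∀ {ℓ h ts} (i : Fin (length ts)) →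
         _⋖_ {node ℓ h ts} here (child i here)
  down : ∀ {ℓ h ts} (i : Fin (length ts)) {u v : Pos (lookup ts i)} →
         u ⋖ v → _⋖_ {node ℓ h ts} (child i u) (child i v)

Adj : ∀ {t} → Pos t → Pos t → Set
Adj u v = u ⋖ v ⊎ v ⋖ u

record RLIso (T T' : Tree) : Set where
  field
    bij       : Pos T ↔ Pos T'
  open Inverse bij public using (to)
  field
    rootPres  : to here ≡ here
    labelPres : ∀ v → labelAt (to v) ≡ labelAt v
    adjPres   : ∀ u v → Adj u v ⇔ Adj (to u) (to v)

-- For a tree T with root label ℓ and n vertices, C T is Eisenstein at the prime
-- p ℓ: its constant term is p ℓ, its other non-leading coefficients are multiples
-- of p ℓ, and its leading coefficient 1 + p ℓ · L is not. So C T is primitive and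
-- irreducible in ℤ[X], and in fact a prime element (by descent on the degree via
-- pseudo-division and Gauss's lemma). Thus C T determines ℓ (constant term), n
-- (degree) and the product of the C's of the children. Two such primes dividing
-- each other are equal, their constant terms being positive primes, so unique
-- factorisation recovers the children's C's up to order, and induction recovers T
-- up to reordering children. Conversely C is invariant under reordering, and the
-- reorderings are exactly the rooted labelled graph isomorphisms, because a
-- bijection preserving adjacency and the root preserves the parent relation.

module Submission where

open import Defs
open import Algebra.Bundles using (CommutativeMonoid; CommutativeRing)
open import Data.Empty using (⊥; ⊥-elim)
open import Data.Fin using (Fin; zero; suc; punchIn)
open import Data.Fin.Permutation as Perm using (Permutation; _⟨$⟩ʳ_; _⟨$⟩ˡ_)
open import Data.Integer as ℤ using (ℤ; +_; -[1+_]; -_; 0ℤ; 1ℤ; _+_; _*_; ∣_∣)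
import Data.Integer.Properties as ℤ
open import Data.Integer.Divisibility.Signed
  using (_∣_; divides; ∣ᵤ⇒∣; ∣⇒∣ᵤ; _∣?_; ∣-refl; ∣m+n∣m⇒∣n; ∣m+n∣n⇒∣m; ∣m⇒∣m*n; ∣n⇒∣m*n)
open import Data.List using (List; []; _∷_; map; length; lookup)
open import Data.List.Relation.Unary.All using (_∷_)
open import Data.Maybe using (Maybe; just; nothing)
open import Data.Nat as ℕ using (ℕ; zero; suc; _≤_; _<_; z≤n; s≤s; _!; NonZero)
import Data.Nat.Properties as ℕ
import Data.Nat.Divisibility as ℕ
open import Data.Nat.Primality
  using (Prime; prime?; prime[2]; euclidsLemma; prime⇒nonZero; prime⇒nonTrivial; prime⇒irreducible)
open import Data.Nat.Primality.Factorisation using (factorise)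
open import Data.Product using (∃; ∃-syntax; ∃₂; _,_; _×_; proj₁; proj₂)
import Data.Product as Product
open import Data.Sum using (_⊎_; inj₁; inj₂; [_,_]′)
import Data.Sum as Sum
open import Data.Vec.Functional using (Vector; removeAt)
open import Function using (_∘_; id)
open import Function.Bundles using (_↔_; _⇔_; Inverse; mk↔ₛ′; mk⇔; Equivalence)
open import Relation.Binary.Bundles using (Setoid)
open import Relation.Binary.Definitions using (tri<; tri≈; tri>)
open import Relation.Binary.PropositionalEquality
import Relation.Binary.Reasoning.Setoid
open import Relation.Nullary using (¬_; yes; no; contradiction)
open import Tactic.RingSolver using (solve-∀)
open import Tactic.RingSolver.Core.AlmostCommutativeRing using (AlmostCommutativeRing; fromCommutativeRing)

-- The primes p i

search-≥ : ∀ f c → c ≤ search f c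
search-≥ zero    c = ℕ.≤-refl
search-≥ (suc f) c with prime? c
... | yes _ = ℕ.≤-refl
... | no  _ = ℕ.≤-trans (ℕ.n≤1+n c) (search-≥ f (suc c))

search-prime : ∀ f c {q} → Prime q → c ≤ q → q < c ℕ.+ f → Prime (search f c)
search-prime zero    c {q} q-prime c≤q q<c+0 = contradiction (subst (q <_) (ℕ.+-identityʳ c) q<c+0) (ℕ.≤⇒≯ c≤q)
search-prime (suc f) c {q} q-prime c≤q q<c+f with prime? c
... | yes c-prime = c-prime
... | no  c-composite with ℕ.m≤n⇒m<n∨m≡n c≤q
...   | inj₂ refl = contradiction q-prime c-composite
...   | inj₁ c<q  = search-prime f (suc c) q-prime c<q (subst (q <_) (ℕ.+-suc c f) q<c+f)

prime-factor : ∀ n → 2 ≤ n → ∃[ q ] Prime q × q ℕ.∣ n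
prime-factor n 2≤n with factorise n {{ℕ.>-nonZero (ℕ.≤-trans (s≤s z≤n) 2≤n)}}
... | record { factors = [] ; isFactorisation = n≡1 } = contradiction (ℕ.≤-reflexive n≡1) (ℕ.<⇒≱ 2≤n)
... | record { factors = q ∷ qs ; isFactorisation = n≡q*qs ; factorsPrime = q-prime ∷ _ } =
  q , q-prime , subst (q ℕ.∣_) (sym n≡q*qs) (ℕ.m∣m*n _)

n∣n! : ∀ n → .{{NonZero n}} → n ℕ.∣ n !
n∣n! (suc n) = ℕ.m∣m*n (n !)

-- Euclid: every prime factor of n ! + 1 exceeds n.
euclid : ∀ n → ∃[ q ] Prime q × n < q × q ≤ suc (n !)
euclid n with prime-factor (suc (n !)) (s≤s (ℕ.1≤n! n))
... | q , q-prime , q∣n!+1 = q , q-prime , n<q , ℕ.∣⇒≤ q∣n!+1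
  where
  instance _ = prime⇒nonZero q-prime
  n<q : n < q
  n<q with n ℕ.<? q
  ... | yes n<q = n<q
  ... | no  n≮q = contradiction (ℕ.∣1⇒≡1 q∣1) (ℕ.nonTrivial⇒≢1 {{prime⇒nonTrivial q-prime}})
    where
    q∣n! : q ℕ.∣ n !
    q∣n! = ℕ.∣-trans (n∣n! q) (ℕ.m≤n⇒m!∣n! (ℕ.≮⇒≥ n≮q))
    q∣1 : q ℕ.∣ 1
    q∣1 = ℕ.∣m+n∣m⇒∣n (subst (q ℕ.∣_) (ℕ.+-comm 1 (n !)) q∣n!+1) q∣n!

nextPrime-> : ∀ n → n < nextPrime n
nextPrime-> n = search-≥ (n !) (suc n)

nextPrime-prime : ∀ n → .{{NonZero n}} → Prime (nextPrime n)
nextPrime-prime n with euclid n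
... | q , q-prime , n<q , q≤n!+1 =
  search-prime (n !) (suc n) q-prime n<q (s≤s (ℕ.≤-trans q≤n!+1 (ℕ.+-monoˡ-≤ (n !) (ℕ.>-nonZero⁻¹ n))))

nthPrime0-prime : ∀ i → Prime (nthPrime0 i)
nthPrime0-prime zero    = prime[2]
nthPrime0-prime (suc i) = nextPrime-prime (nthPrime0 i) {{prime⇒nonZero (nthPrime0-prime i)}}

nthPrime0-strictMono : ∀ {i j} → i < j → nthPrime0 i < nthPrime0 j
nthPrime0-strictMono {i} {suc j} (s≤s i≤j) with ℕ.m≤n⇒m<n∨m≡n i≤j
... | inj₁ i<j  = ℕ.<-trans (nthPrime0-strictMono i<j) (nextPrime-> (nthPrime0 j))
... | inj₂ refl = nextPrime-> (nthPrime0 i)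

nthPrime0-injective : ∀ {i j} → nthPrime0 i ≡ nthPrime0 j → i ≡ j
nthPrime0-injective {i} {j} pᵢ≡pⱼ with ℕ.<-cmp i j
... | tri< i<j _ _ = contradiction pᵢ≡pⱼ (ℕ.<⇒≢ (nthPrime0-strictMono i<j))
... | tri≈ _ i≡j _ = i≡j
... | tri> _ _ j<i = contradiction (sym pᵢ≡pⱼ) (ℕ.<⇒≢ (nthPrime0-strictMono j<i))

p-prime : ∀ i → Prime (p i)
p-prime i = nthPrime0-prime (i ℕ.∸ 1)

p-injective : ∀ {i j} → 1 ≤ i → 1 ≤ j → p i ≡ p j → i ≡ j
p-injective {suc i} {suc j} _ _ pᵢ≡pⱼ = cong suc (nthPrime0-injective pᵢ≡pⱼ)

-- The ring ℤ[X]

ℤ[X] : Set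
ℤ[X] = List ℤ

infixl 6 _⊕_
infixl 7 _⊗_
infix 8 ⊝_
infix 4 _≋_

_⊕_ : ℤ[X] → ℤ[X] → ℤ[X]
[]      ⊕ g       = g
(a ∷ f) ⊕ []      = a ∷ f
(a ∷ f) ⊕ (b ∷ g) = (a + b) ∷ (f ⊕ g)

scale : ℤ → ℤ[X] → ℤ[X]
scale a = map (a *_)

_⊗_ : ℤ[X] → ℤ[X] → ℤ[X]
[]      ⊗ g = []
(a ∷ f) ⊗ g = scale a g ⊕ (0ℤ ∷ f ⊗ g)

⊝_ : ℤ[X] → ℤ[X]
⊝_ = scale (- 1ℤ)

constℤ : ℤ → ℤ[X]
constℤ a = a ∷ []

0ₚ 1ₚ : ℤ[X]
0ₚ = []
1ₚ = constℤ 1ℤ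

xⁿ : ℕ → ℤ[X]
xⁿ zero    = 1ₚ
xⁿ (suc n) = 0ℤ ∷ xⁿ n

coeffℤ : ℤ[X] → ℕ → ℤ
coeffℤ []      _       = 0ℤ
coeffℤ (a ∷ f) zero    = a
coeffℤ (a ∷ f) (suc k) = coeffℤ f k

-- A record, so that both sides stay inferable from a proof.
record _≋_ (f g : ℤ[X]) : Set where
  constructor mk≋
  field coeff-≡ : ∀ k → coeffℤ f k ≡ coeffℤ g k
open _≋_ public

≋-refl : ∀ {f} → f ≋ f
≋-refl = mk≋ λ _ → refl

≋-sym : ∀ {f g} → f ≋ g → g ≋ f
≋-sym f≋g = mk≋ λ k → sym (coeff-≡ f≋g k)

≋-trans : ∀ {f g h} → f ≋ g → g ≋ h → f ≋ h
≋-trans f≋g g≋h = mk≋ λ k → trans (coeff-≡ f≋g k) (coeff-≡ g≋h k)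

≡⇒≋ : ∀ {f g} → f ≡ g → f ≋ g
≡⇒≋ refl = ≋-refl

≋-setoid : Setoid _ _
≋-setoid = record
  { Carrier = ℤ[X] ; _≈_ = _≋_
  ; isEquivalence = record { refl = ≋-refl ; sym = ≋-sym ; trans = ≋-trans } }

∷-cong : ∀ {a b f g} → a ≡ b → f ≋ g → a ∷ f ≋ b ∷ g
∷-cong a≡b f≋g = mk≋ λ { zero → a≡b ; (suc k) → coeff-≡ f≋g k }

∷-injectiveʳ : ∀ {a b f g} → a ∷ f ≋ b ∷ g → f ≋ g
∷-injectiveʳ e = mk≋ λ k → coeff-≡ e (suc k)

0∷0ₚ : 0ℤ ∷ 0ₚ ≋ 0ₚ
0∷0ₚ = mk≋ λ { zero → refl ; (suc k) → refl }

coeff-⊕ : ∀ f g k → coeffℤ (f ⊕ g) k ≡ coeffℤ f k + coeffℤ g k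
coeff-⊕ []      g       k       = sym (ℤ.+-identityˡ _)
coeff-⊕ (a ∷ f) []      k       = sym (ℤ.+-identityʳ _)
coeff-⊕ (a ∷ f) (b ∷ g) zero    = refl
coeff-⊕ (a ∷ f) (b ∷ g) (suc k) = coeff-⊕ f g k

coeff-scale : ∀ a f k → coeffℤ (scale a f) k ≡ a * coeffℤ f k
coeff-scale a []      k       = sym (ℤ.*-zeroʳ a)
coeff-scale a (b ∷ f) zero    = refl
coeff-scale a (b ∷ f) (suc k) = coeff-scale a f k

module _ where
  open ≡-Reasoning

  ⊕-cong : ∀ {f f′ g g′} → f ≋ f′ → g ≋ g′ → f ⊕ g ≋ f′ ⊕ g′
  ⊕-cong {f} {f′} {g} {g′} f≋f′ g≋g′ = mk≋ λ k → begin
    coeffℤ (f ⊕ g) k             ≡⟨ coeff-⊕ f g k ⟩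
    coeffℤ f k + coeffℤ g k      ≡⟨ cong₂ _+_ (coeff-≡ f≋f′ k) (coeff-≡ g≋g′ k) ⟩
    coeffℤ f′ k + coeffℤ g′ k    ≡⟨ coeff-⊕ f′ g′ k ⟨
    coeffℤ (f′ ⊕ g′) k           ∎

  ⊕-assoc : ∀ f g h → f ⊕ g ⊕ h ≋ f ⊕ (g ⊕ h)
  ⊕-assoc f g h = mk≋ λ k → begin
    coeffℤ (f ⊕ g ⊕ h) k                       ≡⟨ coeff-⊕ (f ⊕ g) h k ⟩
    coeffℤ (f ⊕ g) k + coeffℤ h k              ≡⟨ cong (_+ coeffℤ h k) (coeff-⊕ f g k) ⟩
    coeffℤ f k + coeffℤ g k + coeffℤ h k       ≡⟨ ℤ.+-assoc (coeffℤ f k) _ _ ⟩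
    coeffℤ f k + (coeffℤ g k + coeffℤ h k)     ≡⟨ cong (λ x → coeffℤ f k + x) (coeff-⊕ g h k) ⟨
    coeffℤ f k + coeffℤ (g ⊕ h) k              ≡⟨ coeff-⊕ f (g ⊕ h) k ⟨
    coeffℤ (f ⊕ (g ⊕ h)) k                     ∎

  ⊕-comm : ∀ f g → f ⊕ g ≋ g ⊕ f
  ⊕-comm f g = mk≋ λ k → begin
    coeffℤ (f ⊕ g) k          ≡⟨ coeff-⊕ f g k ⟩
    coeffℤ f k + coeffℤ g k   ≡⟨ ℤ.+-comm (coeffℤ f k) _ ⟩
    coeffℤ g k + coeffℤ f k   ≡⟨ coeff-⊕ g f k ⟨
    coeffℤ (g ⊕ f) k          ∎

  ⊕-inverseʳ : ∀ f → f ⊕ ⊝ f ≋ 0ₚ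
  ⊕-inverseʳ f = mk≋ λ k → begin
    coeffℤ (f ⊕ ⊝ f) k                        ≡⟨ coeff-⊕ f (⊝ f) k ⟩
    coeffℤ f k + coeffℤ (⊝ f) k               ≡⟨ cong (λ x → coeffℤ f k + x) (coeff-scale (- 1ℤ) f k) ⟩
    coeffℤ f k + - 1ℤ * coeffℤ f k            ≡⟨ cong (λ x → coeffℤ f k + x) (ℤ.-1*i≡-i (coeffℤ f k)) ⟩
    coeffℤ f k + - coeffℤ f k                 ≡⟨ ℤ.+-inverseʳ (coeffℤ f k) ⟩
    0ℤ                                        ∎

  scale-cong : ∀ a {f g} → f ≋ g → scale a f ≋ scale a g
  scale-cong a {f} {g} f≋g = mk≋ λ k → begin
    coeffℤ (scale a f) k   ≡⟨ coeff-scale a f k ⟩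
    a * coeffℤ f k         ≡⟨ cong (a *_) (coeff-≡ f≋g k) ⟩
    a * coeffℤ g k         ≡⟨ coeff-scale a g k ⟨
    coeffℤ (scale a g) k   ∎

  scale-distrib-⊕ : ∀ a f g → scale a (f ⊕ g) ≋ scale a f ⊕ scale a g
  scale-distrib-⊕ a f g = mk≋ λ k → begin
    coeffℤ (scale a (f ⊕ g)) k                      ≡⟨ coeff-scale a (f ⊕ g) k ⟩
    a * coeffℤ (f ⊕ g) k                            ≡⟨ cong (a *_) (coeff-⊕ f g k) ⟩
    a * (coeffℤ f k + coeffℤ g k)                   ≡⟨ ℤ.*-distribˡ-+ a (coeffℤ f k) _ ⟩
    a * coeffℤ f k + a * coeffℤ g k                 ≡⟨ cong₂ _+_ (coeff-scale a f k) (coeff-scale a g k) ⟨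
    coeffℤ (scale a f) k + coeffℤ (scale a g) k     ≡⟨ coeff-⊕ (scale a f) (scale a g) k ⟨
    coeffℤ (scale a f ⊕ scale a g) k                ∎

  scale-distribʳ-+ : ∀ a b f → scale (a + b) f ≋ scale a f ⊕ scale b f
  scale-distribʳ-+ a b f = mk≋ λ k → begin
    coeffℤ (scale (a + b) f) k                      ≡⟨ coeff-scale (a + b) f k ⟩
    (a + b) * coeffℤ f k                            ≡⟨ ℤ.*-distribʳ-+ (coeffℤ f k) a b ⟩
    a * coeffℤ f k + b * coeffℤ f k                 ≡⟨ cong₂ _+_ (coeff-scale a f k) (coeff-scale b f k) ⟨
    coeffℤ (scale a f) k + coeffℤ (scale b f) k     ≡⟨ coeff-⊕ (scale a f) (scale b f) k ⟨
    coeffℤ (scale a f ⊕ scale b f) k                ∎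

  scale-assoc : ∀ a b f → scale a (scale b f) ≋ scale (a * b) f
  scale-assoc a b f = mk≋ λ k → begin
    coeffℤ (scale a (scale b f)) k   ≡⟨ coeff-scale a (scale b f) k ⟩
    a * coeffℤ (scale b f) k         ≡⟨ cong (a *_) (coeff-scale b f k) ⟩
    a * (b * coeffℤ f k)             ≡⟨ ℤ.*-assoc a b _ ⟨
    a * b * coeffℤ f k               ≡⟨ coeff-scale (a * b) f k ⟨
    coeffℤ (scale (a * b) f) k       ∎

  scale-identityˡ : ∀ f → scale 1ℤ f ≋ f
  scale-identityˡ f = mk≋ λ k → trans (coeff-scale 1ℤ f k) (ℤ.*-identityˡ _)

  scale-zeroˡ : ∀ f → scale 0ℤ f ≋ 0ₚ
  scale-zeroˡ f = mk≋ λ k → coeff-scale 0ℤ f k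

⊝-cong : ∀ {f g} → f ≋ g → ⊝ f ≋ ⊝ g
⊝-cong = scale-cong (- 1ℤ)

⊕-congˡ : ∀ f {g h} → g ≋ h → f ⊕ g ≋ f ⊕ h
⊕-congˡ f = ⊕-cong ≋-refl

⊕-congʳ : ∀ h {f g} → f ≋ g → f ⊕ h ≋ g ⊕ h
⊕-congʳ h f≋g = ⊕-cong f≋g ≋-refl

⊕-identityʳ : ∀ f → f ⊕ 0ₚ ≋ f
⊕-identityʳ []      = ≋-refl
⊕-identityʳ (a ∷ f) = ≋-refl

⊕-commutativeMonoid : CommutativeMonoid _ _
⊕-commutativeMonoid = record
  { Carrier = ℤ[X] ; _≈_ = _≋_ ; _∙_ = _⊕_ ; ε = 0ₚ
  ; isCommutativeMonoid = record
    { isMonoid = record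
      { isSemigroup = record
        { isMagma = record { isEquivalence = Setoid.isEquivalence ≋-setoid ; ∙-cong = ⊕-cong }
        ; assoc = ⊕-assoc }
      ; identity = (λ _ → ≋-refl) , ⊕-identityʳ }
    ; comm = ⊕-comm } }

open import Algebra.Properties.CommutativeSemigroup
  (CommutativeMonoid.commutativeSemigroup ⊕-commutativeMonoid)
  using (interchange; x∙yz≈y∙xz)

module ≋-Reasoning = Relation.Binary.Reasoning.Setoid ≋-setoid

⊗-congˡ : ∀ f {g g′} → g ≋ g′ → f ⊗ g ≋ f ⊗ g′
⊗-congˡ []      g≋g′ = ≋-refl
⊗-congˡ (a ∷ f) g≋g′ = ⊕-cong (scale-cong a g≋g′) (∷-cong refl (⊗-congˡ f g≋g′))

⊗-distribˡ-⊕ : ∀ f g h → f ⊗ (g ⊕ h) ≋ f ⊗ g ⊕ f ⊗ h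
⊗-distribˡ-⊕ []      g h = ≋-refl
⊗-distribˡ-⊕ (a ∷ f) g h = begin
  scale a (g ⊕ h) ⊕ (0ℤ ∷ f ⊗ (g ⊕ h))
    ≈⟨ ⊕-cong (scale-distrib-⊕ a g h) (∷-cong refl (⊗-distribˡ-⊕ f g h)) ⟩
  (scale a g ⊕ scale a h) ⊕ ((0ℤ ∷ f ⊗ g) ⊕ (0ℤ ∷ f ⊗ h))
    ≈⟨ interchange (scale a g) (scale a h) _ _ ⟩
  (a ∷ f) ⊗ g ⊕ (a ∷ f) ⊗ h ∎
  where open ≋-Reasoning

⊗-distribʳ-⊕ : ∀ f g h → (f ⊕ g) ⊗ h ≋ f ⊗ h ⊕ g ⊗ h
⊗-distribʳ-⊕ []      g       h = ≋-refl
⊗-distribʳ-⊕ (a ∷ f) []      h = ≋-sym (⊕-identityʳ _)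
⊗-distribʳ-⊕ (a ∷ f) (b ∷ g) h = begin
  scale (a + b) h ⊕ (0ℤ ∷ (f ⊕ g) ⊗ h)
    ≈⟨ ⊕-cong (scale-distribʳ-+ a b h) (∷-cong refl (⊗-distribʳ-⊕ f g h)) ⟩
  (scale a h ⊕ scale b h) ⊕ ((0ℤ ∷ f ⊗ h) ⊕ (0ℤ ∷ g ⊗ h))
    ≈⟨ interchange (scale a h) (scale b h) _ _ ⟩
  (a ∷ f) ⊗ h ⊕ (b ∷ g) ⊗ h ∎
  where open ≋-Reasoning

⊗-zeroʳ : ∀ f → f ⊗ 0ₚ ≋ 0ₚ
⊗-zeroʳ []      = ≋-refl
⊗-zeroʳ (a ∷ f) = ≋-trans (∷-cong refl (⊗-zeroʳ f)) 0∷0ₚ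

0∷-⊗ : ∀ f g → (0ℤ ∷ f) ⊗ g ≋ 0ℤ ∷ f ⊗ g
0∷-⊗ f g = ⊕-cong (scale-zeroˡ g) ≋-refl

scale-⊗ : ∀ a f g → scale a f ⊗ g ≋ scale a (f ⊗ g)
scale-⊗ a []      g = ≋-refl
scale-⊗ a (b ∷ f) g = begin
  scale (a * b) g ⊕ (0ℤ ∷ scale a f ⊗ g)
    ≈⟨ ⊕-cong (≋-sym (scale-assoc a b g)) (∷-cong (sym (ℤ.*-zeroʳ a)) (scale-⊗ a f g)) ⟩
  scale a (scale b g) ⊕ scale a (0ℤ ∷ f ⊗ g)
    ≈⟨ scale-distrib-⊕ a (scale b g) _ ⟨
  scale a ((b ∷ f) ⊗ g) ∎
  where open ≋-Reasoning

⊗-assoc : ∀ f g h → f ⊗ g ⊗ h ≋ f ⊗ (g ⊗ h)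
⊗-assoc []      g h = ≋-refl
⊗-assoc (a ∷ f) g h = begin
  (scale a g ⊕ (0ℤ ∷ f ⊗ g)) ⊗ h        ≈⟨ ⊗-distribʳ-⊕ (scale a g) _ h ⟩
  scale a g ⊗ h ⊕ (0ℤ ∷ f ⊗ g) ⊗ h      ≈⟨ ⊕-cong (scale-⊗ a g h) (0∷-⊗ (f ⊗ g) h) ⟩
  scale a (g ⊗ h) ⊕ (0ℤ ∷ f ⊗ g ⊗ h)    ≈⟨ ⊕-cong ≋-refl (∷-cong refl (⊗-assoc f g h)) ⟩
  (a ∷ f) ⊗ (g ⊗ h)                     ∎
  where open ≋-Reasoning

⊗-∷ : ∀ f b g → f ⊗ (b ∷ g) ≋ scale b f ⊕ (0ℤ ∷ f ⊗ g)
⊗-∷ []      b g = ≋-sym 0∷0ₚ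
⊗-∷ (a ∷ f) b g = ∷-cong (cong (_+ 0ℤ) (ℤ.*-comm a b)) (begin
  scale a g ⊕ f ⊗ (b ∷ g)                    ≈⟨ ⊕-cong ≋-refl (⊗-∷ f b g) ⟩
  scale a g ⊕ (scale b f ⊕ (0ℤ ∷ f ⊗ g))     ≈⟨ x∙yz≈y∙xz (scale a g) (scale b f) _ ⟩
  scale b f ⊕ (scale a g ⊕ (0ℤ ∷ f ⊗ g))     ∎)
  where open ≋-Reasoning

⊗-comm : ∀ f g → f ⊗ g ≋ g ⊗ f
⊗-comm []      g = ≋-sym (⊗-zeroʳ g)
⊗-comm (a ∷ f) g = ≋-trans (⊕-cong ≋-refl (∷-cong refl (⊗-comm f g))) (≋-sym (⊗-∷ g a f))

⊗-congʳ : ∀ {f f′} g → f ≋ f′ → f ⊗ g ≋ f′ ⊗ g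
⊗-congʳ {f} {f′} g f≋f′ = begin
  f ⊗ g    ≈⟨ ⊗-comm f g ⟩
  g ⊗ f    ≈⟨ ⊗-congˡ g f≋f′ ⟩
  g ⊗ f′   ≈⟨ ⊗-comm g f′ ⟩
  f′ ⊗ g   ∎
  where open ≋-Reasoning

⊗-cong : ∀ {f f′ g g′} → f ≋ f′ → g ≋ g′ → f ⊗ g ≋ f′ ⊗ g′
⊗-cong {f′ = f′} {g = g} f≋f′ g≋g′ = ≋-trans (⊗-congʳ g f≋f′) (⊗-congˡ f′ g≋g′)

⊗-identityˡ : ∀ f → 1ₚ ⊗ f ≋ f
⊗-identityˡ f = ≋-trans (⊕-cong (scale-identityˡ f) 0∷0ₚ) (⊕-identityʳ f)

ℤ[X]-commutativeRing : CommutativeRing _ _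
ℤ[X]-commutativeRing = record
  { Carrier = ℤ[X] ; _≈_ = _≋_ ; _+_ = _⊕_ ; _*_ = _⊗_ ; -_ = ⊝_ ; 0# = 0ₚ ; 1# = 1ₚ
  ; isCommutativeRing = record
    { isRing = record
      { +-isAbelianGroup = record
        { isGroup = record
          { isMonoid = CommutativeMonoid.isMonoid ⊕-commutativeMonoid
          ; inverse = (λ f → ≋-trans (⊕-comm (⊝ f) f) (⊕-inverseʳ f)) , ⊕-inverseʳ
          ; ⁻¹-cong = ⊝-cong }
        ; comm = ⊕-comm }
      ; *-cong = ⊗-cong
      ; *-assoc = ⊗-assoc
      ; *-identity = ⊗-identityˡ , (λ f → ≋-trans (⊗-comm f 1ₚ) (⊗-identityˡ f))
      ; distrib = ⊗-distribˡ-⊕ , λ h f g → ⊗-distribʳ-⊕ f g h }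
    ; *-comm = ⊗-comm } }

ℤ[X]-ring : AlmostCommutativeRing _ _
ℤ[X]-ring = fromCommutativeRing ℤ[X]-commutativeRing 0ₚ≟
  where
  -- Without a zero test the solver cannot cancel monomials such as f ⊕ ⊝ f.
  0ₚ≟ : ∀ f → Maybe (0ₚ ≋ f)
  0ₚ≟ []      = just ≋-refl
  0ₚ≟ (a ∷ f) with a ℤ.≟ 0ℤ | 0ₚ≟ f
  ... | yes refl | just 0≋f = just (≋-trans (≋-sym 0∷0ₚ) (∷-cong refl 0≋f))
  ... | _        | _        = nothing

coeff-⊝ : ∀ f k → coeffℤ (⊝ f) k ≡ - coeffℤ f k
coeff-⊝ f k = trans (coeff-scale (- 1ℤ) f k) (ℤ.-1*i≡-i (coeffℤ f k))

scale-≋-constℤ⊗ : ∀ a f → scale a f ≋ constℤ a ⊗ f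
scale-≋-constℤ⊗ a f = ≋-sym (≋-trans (⊕-cong ≋-refl 0∷0ₚ) (⊕-identityʳ (scale a f)))

-- Degrees and pseudo-division

IsZero : ℤ[X] → Set
IsZero f = f ≋ 0ₚ

record DegreeBelow (f : ℤ[X]) (n : ℕ) : Set where
  constructor mkDegreeBelow
  field vanishes : ∀ k → n ≤ k → coeffℤ f k ≡ 0ℤ
open DegreeBelow public

record HasDegree (f : ℤ[X]) (n : ℕ) : Set where
  constructor mkHasDegree
  field
    leading≢0 : coeffℤ f n ≢ 0ℤ
    below     : DegreeBelow f (suc n)
open HasDegree public

*-≢0 : ∀ {a b} → a ≢ 0ℤ → b ≢ 0ℤ → a * b ≢ 0ℤ
*-≢0 {a} a≢0 b≢0 ab≡0 with ℤ.i*j≡0⇒i≡0∨j≡0 a ab≡0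
... | inj₁ a≡0 = a≢0 a≡0
... | inj₂ b≡0 = b≢0 b≡0

coeff-∷⊗-zero : ∀ a f g → coeffℤ ((a ∷ f) ⊗ g) 0 ≡ a * coeffℤ g 0
coeff-∷⊗-zero a f g = trans (coeff-⊕ (scale a g) _ 0) (trans (ℤ.+-identityʳ _) (coeff-scale a g 0))

coeff-∷⊗-suc : ∀ a f g k → coeffℤ ((a ∷ f) ⊗ g) (suc k) ≡ a * coeffℤ g (suc k) + coeffℤ (f ⊗ g) k
coeff-∷⊗-suc a f g k = trans (coeff-⊕ (scale a g) _ (suc k)) (cong (_+ coeffℤ (f ⊗ g) k) (coeff-scale a g (suc k)))

coeff-⊗-zero : ∀ f g → coeffℤ (f ⊗ g) 0 ≡ coeffℤ f 0 * coeffℤ g 0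
coeff-⊗-zero []      g = refl
coeff-⊗-zero (a ∷ f) g = coeff-∷⊗-zero a f g

DegreeBelow-mono : ∀ {f m n} → m ≤ n → DegreeBelow f m → DegreeBelow f n
DegreeBelow-mono m≤n f<m = mkDegreeBelow λ k n≤k → vanishes f<m k (ℕ.≤-trans m≤n n≤k)

DegreeBelow-resp-≋ : ∀ {f g n} → f ≋ g → DegreeBelow f n → DegreeBelow g n
DegreeBelow-resp-≋ f≋g f<n = mkDegreeBelow λ k n≤k → trans (sym (coeff-≡ f≋g k)) (vanishes f<n k n≤k)

HasDegree-resp-≋ : ∀ {f g n} → f ≋ g → HasDegree f n → HasDegree g n
HasDegree-resp-≋ {n = n} f≋g (mkHasDegree lc≢0 f<n) =
  mkHasDegree (λ lc≡0 → lc≢0 (trans (coeff-≡ f≋g n) lc≡0)) (DegreeBelow-resp-≋ f≋g f<n)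

DegreeBelow-zero : ∀ {f} → DegreeBelow f 0 → IsZero f
DegreeBelow-zero f<0 = mk≋ λ k → vanishes f<0 k z≤n

IsZero⇒DegreeBelow : ∀ {f} → IsZero f → ∀ n → DegreeBelow f n
IsZero⇒DegreeBelow f≋0 n = mkDegreeBelow λ k _ → coeff-≡ f≋0 k

DegreeBelow-length : ∀ f → DegreeBelow f (length f)
DegreeBelow-length []      = mkDegreeBelow λ _ _ → refl
DegreeBelow-length (a ∷ f) = mkDegreeBelow λ { (suc k) (s≤s n≤k) → vanishes (DegreeBelow-length f) k n≤k }

HasDegree⇒≤ : ∀ {f d n} → HasDegree f d → DegreeBelow f (suc n) → d ≤ n
HasDegree⇒≤ {d = d} {n} f°d f<n with d ℕ.≤? n
... | yes d≤n = d≤n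
... | no  d≰n = ⊥-elim (leading≢0 f°d (vanishes f<n d (ℕ.≰⇒> d≰n)))

HasDegree-unique : ∀ {f m n} → HasDegree f m → HasDegree f n → m ≡ n
HasDegree-unique {m = m} {n} f°m f°n with ℕ.<-cmp m n
... | tri< m<n _ _ = ⊥-elim (leading≢0 f°n (vanishes (below f°m) n m<n))
... | tri≈ _ m≡n _ = m≡n
... | tri> _ _ n<m = ⊥-elim (leading≢0 f°m (vanishes (below f°n) m n<m))

HasDegree⇒¬IsZero : ∀ {f n} → HasDegree f n → ¬ IsZero f
HasDegree⇒¬IsZero {n = n} f°n f≋0 = leading≢0 f°n (coeff-≡ f≋0 n)

isZero⊎hasDegree : ∀ f → IsZero f ⊎ ∃ (HasDegree f)
isZero⊎hasDegree [] = inj₁ ≋-refl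
isZero⊎hasDegree (a ∷ f) with isZero⊎hasDegree f
... | inj₂ (n , mkHasDegree lc≢0 f<n) =
  inj₂ (suc n , mkHasDegree lc≢0 (mkDegreeBelow λ { (suc k) (s≤s n≤k) → vanishes f<n k n≤k }))
... | inj₁ f≋0 with a ℤ.≟ 0ℤ
...   | yes refl = inj₁ (≋-trans (∷-cong refl f≋0) 0∷0ₚ)
...   | no  a≢0  = inj₂ (0 , mkHasDegree a≢0 (mkDegreeBelow λ { (suc k) _ → coeff-≡ f≋0 k }))

∷⊗-≋-scale : ∀ a {f} g → IsZero f → (a ∷ f) ⊗ g ≋ scale a g
∷⊗-≋-scale a {f} g f≋0 = begin
  scale a g ⊕ (0ℤ ∷ f ⊗ g)     ≈⟨ ⊕-cong ≋-refl (∷-cong refl (⊗-congʳ g f≋0)) ⟩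
  scale a g ⊕ (0ℤ ∷ 0ₚ)        ≈⟨ ⊕-cong ≋-refl 0∷0ₚ ⟩
  scale a g ⊕ 0ₚ               ≈⟨ ⊕-identityʳ (scale a g) ⟩
  scale a g                    ∎
  where open ≋-Reasoning

∷-DegreeBelow⁻ : ∀ {a f n} → DegreeBelow (a ∷ f) (suc n) → DegreeBelow f n
∷-DegreeBelow⁻ af<n = mkDegreeBelow λ k n≤k → vanishes af<n (suc k) (s≤s n≤k)

module _ {g : ℤ[X]} {m : ℕ} (g<m : DegreeBelow g (suc m)) where

  open ≡-Reasoning

  private
    a*g≡0 : ∀ a k → suc m ≤ k → a * coeffℤ g k ≡ 0ℤ
    a*g≡0 a k m<k = trans (cong (a *_) (vanishes g<m k m<k)) (ℤ.*-zeroʳ a)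

  coeff-⊗-top : ∀ f n → DegreeBelow f (suc n) → coeffℤ (f ⊗ g) (n ℕ.+ m) ≡ coeffℤ f n * coeffℤ g m
  coeff-⊗-top []      n       _    = refl
  coeff-⊗-top (a ∷ f) zero    af<1 = begin
    coeffℤ ((a ∷ f) ⊗ g) m   ≡⟨ coeff-≡ (∷⊗-≋-scale a g (DegreeBelow-zero (∷-DegreeBelow⁻ af<1))) m ⟩
    coeffℤ (scale a g) m     ≡⟨ coeff-scale a g m ⟩
    a * coeffℤ g m           ∎
  coeff-⊗-top (a ∷ f) (suc n) af<n = begin
    coeffℤ ((a ∷ f) ⊗ g) (suc n ℕ.+ m)                      ≡⟨ coeff-∷⊗-suc a f g (n ℕ.+ m) ⟩
    a * coeffℤ g (suc n ℕ.+ m) + coeffℤ (f ⊗ g) (n ℕ.+ m)   ≡⟨ cong₂ _+_ (a*g≡0 a _ (s≤s (ℕ.m≤n+m m n)))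
                                                                        (coeff-⊗-top f n (∷-DegreeBelow⁻ af<n)) ⟩
    0ℤ + coeffℤ f n * coeffℤ g m                            ≡⟨ ℤ.+-identityˡ _ ⟩
    coeffℤ f n * coeffℤ g m                                 ∎

  DegreeBelow-⊗ : ∀ f n → DegreeBelow f (suc n) → DegreeBelow (f ⊗ g) (suc (n ℕ.+ m))
  DegreeBelow-⊗ []      n       _    = mkDegreeBelow λ _ _ → refl
  DegreeBelow-⊗ (a ∷ f) zero    af<1 = mkDegreeBelow λ k m<k → begin
    coeffℤ ((a ∷ f) ⊗ g) k   ≡⟨ coeff-≡ (∷⊗-≋-scale a g (DegreeBelow-zero (∷-DegreeBelow⁻ af<1))) k ⟩
    coeffℤ (scale a g) k     ≡⟨ coeff-scale a g k ⟩
    a * coeffℤ g k           ≡⟨ a*g≡0 a k m<k ⟩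
    0ℤ                       ∎
  DegreeBelow-⊗ (a ∷ f) (suc n) af<n = mkDegreeBelow vanish
    where
    vanish : ∀ k → suc (suc n ℕ.+ m) ≤ k → coeffℤ ((a ∷ f) ⊗ g) k ≡ 0ℤ
    vanish (suc k) (s≤s n+m<k) = begin
      coeffℤ ((a ∷ f) ⊗ g) (suc k)                ≡⟨ coeff-∷⊗-suc a f g k ⟩
      a * coeffℤ g (suc k) + coeffℤ (f ⊗ g) k     ≡⟨ cong₂ _+_ (a*g≡0 a (suc k) m<1+k) (vanishes f⊗g<n+m k n+m<k) ⟩
      0ℤ                                          ∎
      where
      m<1+k : suc m ≤ suc k
      m<1+k = s≤s (ℕ.≤-trans (ℕ.m≤n+m m n) (ℕ.≤-trans (ℕ.n≤1+n _) n+m<k))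
      f⊗g<n+m : DegreeBelow (f ⊗ g) (suc (n ℕ.+ m))
      f⊗g<n+m = DegreeBelow-⊗ f n (∷-DegreeBelow⁻ af<n)

HasDegree-⊗ : ∀ {f g n m} → HasDegree f n → HasDegree g m → HasDegree (f ⊗ g) (n ℕ.+ m)
HasDegree-⊗ {f} {g} {n} {m} (mkHasDegree lf≢0 f<n) (mkHasDegree lg≢0 g<m) = mkHasDegree
  (λ lc≡0 → *-≢0 lf≢0 lg≢0 (trans (sym (coeff-⊗-top g<m f n f<n)) lc≡0))
  (DegreeBelow-⊗ g<m f n f<n)

⊗-zero-divisor : ∀ {f g n} → HasDegree f n → IsZero (f ⊗ g) → IsZero g
⊗-zero-divisor {g = g} f°n fg≋0 with isZero⊎hasDegree g
... | inj₁ g≋0       = g≋0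
... | inj₂ (_ , g°m) = ⊥-elim (HasDegree⇒¬IsZero (HasDegree-⊗ f°n g°m) fg≋0)

⊕-cancelˡ : ∀ f {g h} → f ⊕ g ≋ f ⊕ h → g ≋ h
⊕-cancelˡ f {g} {h} fg≋fh = begin
  g                ≈⟨ g≈-f+[f+g] f g ⟩
  ⊝ f ⊕ (f ⊕ g)    ≈⟨ ⊕-congˡ (⊝ f) fg≋fh ⟩
  ⊝ f ⊕ (f ⊕ h)    ≈⟨ g≈-f+[f+g] f h ⟨
  h                ∎
  where
  open ≋-Reasoning
  g≈-f+[f+g] : ∀ f g → g ≋ ⊝ f ⊕ (f ⊕ g)
  g≈-f+[f+g] = solve-∀ ℤ[X]-ring

⊗-cancelˡ : ∀ {f n} → HasDegree f n → ∀ g h → f ⊗ g ≋ f ⊗ h → g ≋ h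
⊗-cancelˡ {f} f°n g h fg≋fh = begin
  g                  ≈⟨ g≈[g-h]+h g h ⟩
  (g ⊕ ⊝ h) ⊕ h      ≈⟨ ⊕-cong (⊗-zero-divisor f°n f[g-h]≋0) ≋-refl ⟩
  0ₚ ⊕ h             ∎
  where
  open ≋-Reasoning
  g≈[g-h]+h : ∀ g h → g ≋ (g ⊕ ⊝ h) ⊕ h
  g≈[g-h]+h = solve-∀ ℤ[X]-ring
  f[g-h]≈fg-fh : ∀ f g h → f ⊗ (g ⊕ ⊝ h) ≋ f ⊗ g ⊕ ⊝ (f ⊗ h)
  f[g-h]≈fg-fh = solve-∀ ℤ[X]-ring
  f[g-h]≋0 : IsZero (f ⊗ (g ⊕ ⊝ h))
  f[g-h]≋0 = begin
    f ⊗ (g ⊕ ⊝ h)         ≈⟨ f[g-h]≈fg-fh f g h ⟩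
    f ⊗ g ⊕ ⊝ (f ⊗ h)     ≈⟨ ⊕-cong fg≋fh ≋-refl ⟩
    f ⊗ h ⊕ ⊝ (f ⊗ h)     ≈⟨ ⊕-inverseʳ (f ⊗ h) ⟩
    0ₚ                    ∎

DegreeBelow-multiple⇒IsZero : ∀ {f n} → HasDegree f n → ∀ {r} s → r ≋ f ⊗ s → DegreeBelow r n → IsZero r
DegreeBelow-multiple⇒IsZero {f} {n} f°n {r} s r≋fs r<n with isZero⊎hasDegree s
... | inj₁ s≋0       = ≋-trans r≋fs (≋-trans (⊗-congˡ f s≋0) (⊗-zeroʳ f))
... | inj₂ (m , s°m) = ⊥-elim (leading≢0 (HasDegree-⊗ f°n s°m)
                          (trans (sym (coeff-≡ r≋fs (n ℕ.+ m))) (vanishes r<n _ (ℕ.m≤m+n n m))))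

HasDegree-scale : ∀ {a f n} → a ≢ 0ℤ → HasDegree f n → HasDegree (scale a f) n
HasDegree-scale {a} {f} {n} a≢0 (mkHasDegree lc≢0 f<n) = mkHasDegree
  (λ alc≡0 → *-≢0 a≢0 lc≢0 (trans (sym (coeff-scale a f n)) alc≡0))
  (mkDegreeBelow λ k n<k → trans (coeff-scale a f k) (trans (cong (a *_) (vanishes f<n k n<k)) (ℤ.*-zeroʳ a)))

coeff-xⁿ⊗ : ∀ j g k → j ≤ k → coeffℤ (xⁿ j ⊗ g) k ≡ coeffℤ g (k ℕ.∸ j)
coeff-xⁿ⊗ zero    g k       _         = coeff-≡ (⊗-identityˡ g) k
coeff-xⁿ⊗ (suc j) g (suc k) (s≤s j≤k) = trans (coeff-≡ (0∷-⊗ (xⁿ j) g) (suc k)) (coeff-xⁿ⊗ j g k j≤k)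

record PseudoDivision (f g : ℤ[X]) (d : ℕ) : Set where
  constructor mkPseudoDivision
  field
    {c}       : ℤ
    {quo rem} : ℤ[X]
    c≢0       : c ≢ 0ℤ
    equation  : scale c f ≋ quo ⊗ g ⊕ rem
    rem<d     : DegreeBelow rem d

cancel-leading : ∀ {f g d N} → HasDegree g d → d ≤ N → DegreeBelow f (suc N) →
                 DegreeBelow (scale (coeffℤ g d) f ⊕ ⊝ scale (coeffℤ f N) (xⁿ (N ℕ.∸ d) ⊗ g)) N
cancel-leading {f} {g} {d} {N} g°d d≤N f<N = mkDegreeBelow λ k N≤k → trans (coeff-f′ k N≤k) (vanish k N≤k)
  where
  open ≡-Reasoning
  a = coeffℤ g d
  b = coeffℤ f N
  j = N ℕ.∸ d
  xʲg = xⁿ j ⊗ g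
  coeff-f′ : ∀ k → N ≤ k → coeffℤ (scale a f ⊕ ⊝ scale b xʲg) k ≡ a * coeffℤ f k + - (b * coeffℤ g (k ℕ.∸ j))
  coeff-f′ k N≤k = begin
    coeffℤ (scale a f ⊕ ⊝ scale b xʲg) k               ≡⟨ coeff-⊕ (scale a f) (⊝ scale b xʲg) k ⟩
    coeffℤ (scale a f) k + coeffℤ (⊝ scale b xʲg) k    ≡⟨ cong₂ _+_ (coeff-scale a f k) (coeff-⊝ (scale b xʲg) k) ⟩
    a * coeffℤ f k + - coeffℤ (scale b xʲg) k          ≡⟨ cong (λ x → a * coeffℤ f k + - x) (coeff-scale b xʲg k) ⟩
    a * coeffℤ f k + - (b * coeffℤ xʲg k)              ≡⟨ cong (λ x → a * coeffℤ f k + - (b * x)) (coeff-xⁿ⊗ j g k j≤k) ⟩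
    a * coeffℤ f k + - (b * coeffℤ g (k ℕ.∸ j))        ∎
    where
    j≤k : j ≤ k
    j≤k = ℕ.≤-trans (ℕ.m∸n≤m N d) N≤k
  vanish : ∀ k → N ≤ k → a * coeffℤ f k + - (b * coeffℤ g (k ℕ.∸ j)) ≡ 0ℤ
  vanish k N≤k with ℕ.m≤n⇒m<n∨m≡n N≤k
  ... | inj₂ refl = begin
    a * b + - (b * coeffℤ g (N ℕ.∸ j))   ≡⟨ cong (λ i → a * b + - (b * coeffℤ g i)) (ℕ.m∸[m∸n]≡n d≤N) ⟩
    a * b + - (b * a)                     ≡⟨ cong (λ x → a * b + - x) (ℤ.*-comm b a) ⟩
    a * b + - (a * b)                     ≡⟨ ℤ.+-inverseʳ (a * b) ⟩
    0ℤ                                    ∎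
  ... | inj₁ N<k = begin
    a * coeffℤ f k + - (b * coeffℤ g (k ℕ.∸ j))   ≡⟨ cong₂ (λ x y → a * x + - (b * y)) (vanishes f<N k N<k)
                                                             (vanishes (below g°d) (k ℕ.∸ j) d<k-j) ⟩
    a * 0ℤ + - (b * 0ℤ)                           ≡⟨ cong₂ (λ x y → x + - y) (ℤ.*-zeroʳ a) (ℤ.*-zeroʳ b) ⟩
    0ℤ                                            ∎
    where
    d<k-j : d < k ℕ.∸ j
    d<k-j = subst (_< k ℕ.∸ j) (ℕ.m∸[m∸n]≡n d≤N) (ℕ.∸-monoˡ-< N<k (ℕ.m∸n≤m N d))

PseudoDivision-lift : ∀ {f g d a} b j → a ≢ 0ℤ →
                      PseudoDivision (scale a f ⊕ ⊝ scale b (xⁿ j ⊗ g)) g d → PseudoDivision f g d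
PseudoDivision-lift {f} {g} {a = a} b j a≢0 (mkPseudoDivision {c} {q} {r} c≢0 cf′≋qg+r r<d) =
  mkPseudoDivision {c = c * a} {quo = q ⊕ scale (c * b) (xⁿ j)} (*-≢0 c≢0 a≢0) eq r<d
  where
  open ≋-Reasoning
  A≋[A-B]+B : ∀ A B → A ≋ (A ⊕ ⊝ B) ⊕ B
  A≋[A-B]+B = solve-∀ ℤ[X]-ring
  regroup : ∀ Q G R S → (Q ⊗ G ⊕ R) ⊕ S ⊗ G ≋ (Q ⊕ S) ⊗ G ⊕ R
  regroup = solve-∀ ℤ[X]-ring
  B = scale b (xⁿ j ⊗ g)
  eq : scale (c * a) f ≋ (q ⊕ scale (c * b) (xⁿ j)) ⊗ g ⊕ r
  eq = begin
    scale (c * a) f                              ≈⟨ scale-assoc c a f ⟨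
    scale c (scale a f)                          ≈⟨ scale-cong c (A≋[A-B]+B (scale a f) B) ⟩
    scale c ((scale a f ⊕ ⊝ B) ⊕ B)              ≈⟨ scale-distrib-⊕ c (scale a f ⊕ ⊝ B) B ⟩
    scale c (scale a f ⊕ ⊝ B) ⊕ scale c B        ≈⟨ ⊕-cong cf′≋qg+r (scale-assoc c b (xⁿ j ⊗ g)) ⟩
    (q ⊗ g ⊕ r) ⊕ scale (c * b) (xⁿ j ⊗ g)       ≈⟨ ⊕-congˡ (q ⊗ g ⊕ r) (scale-⊗ (c * b) (xⁿ j) g) ⟨
    (q ⊗ g ⊕ r) ⊕ scale (c * b) (xⁿ j) ⊗ g       ≈⟨ regroup q g r (scale (c * b) (xⁿ j)) ⟩
    (q ⊕ scale (c * b) (xⁿ j)) ⊗ g ⊕ r           ∎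

pseudo-divide : ∀ {g d} → HasDegree g d → ∀ N {f} → DegreeBelow f N → PseudoDivision f g d
pseudo-divide {g} {d} g°d N {f} f<N with N ℕ.≤? d
... | yes N≤d = mkPseudoDivision {c = 1ℤ} {0ₚ} {f} (λ ()) (scale-identityˡ f) (DegreeBelow-mono N≤d f<N)
pseudo-divide {g} {d} g°d zero    {f} f<N | no N≰d = ⊥-elim (N≰d z≤n)
pseudo-divide {g} {d} g°d (suc N) {f} f<N | no N≰d = PseudoDivision-lift (coeffℤ f N) (N ℕ.∸ d) (leading≢0 g°d)
  (pseudo-divide g°d N (cancel-leading g°d (ℕ.≤-pred (ℕ.≰⇒> N≰d)) f<N))

HasDegree-0⇒≋constℤ : ∀ {f} → HasDegree f 0 → f ≋ constℤ (coeffℤ f 0)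
HasDegree-0⇒≋constℤ f°0 = mk≋ λ { zero → refl ; (suc k) → vanishes (below f°0) (suc k) (s≤s z≤n) }

-- Contents and Gauss's lemma

infix 4 _∣ᶜ_ _∣ₚ_

record _∣ᶜ_ (q : ℕ) (f : ℤ[X]) : Set where
  constructor mk∣ᶜ
  field ∣coeff : ∀ k → + q ∣ coeffℤ f k
open _∣ᶜ_ public

record _∣ₚ_ (f g : ℤ[X]) : Set where
  constructor mk∣ₚ
  field
    quotient : ℤ[X]
    g≋f⊗quotient : g ≋ f ⊗ quotient

∣ᶜ-resp-≋ : ∀ {q f g} → f ≋ g → q ∣ᶜ f → q ∣ᶜ g
∣ᶜ-resp-≋ f≋g q∣f = mk∣ᶜ λ k → subst (_ ∣_) (coeff-≡ f≋g k) (∣coeff q∣f k)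

∣ᶜ-0ₚ : ∀ {q} → q ∣ᶜ 0ₚ
∣ᶜ-0ₚ = mk∣ᶜ λ _ → divides 0ℤ refl

∣ᶜ-∷ : ∀ {q a f} → + q ∣ a → q ∣ᶜ f → q ∣ᶜ a ∷ f
∣ᶜ-∷ q∣a q∣f = mk∣ᶜ λ { zero → q∣a ; (suc k) → ∣coeff q∣f k }

∣ᶜ-scale : ∀ {q a} → + q ∣ a → ∀ f → q ∣ᶜ scale a f
∣ᶜ-scale {q} {a} q∣a f = mk∣ᶜ λ k → subst (_ ∣_) (sym (coeff-scale a f k)) (∣m⇒∣m*n (coeffℤ f k) q∣a)

∣ᶜ-shift : ∀ {q a} g {r} → + q ∣ a → q ∣ᶜ scale a g ⊕ (0ℤ ∷ r) → q ∣ᶜ r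
∣ᶜ-shift {q} {a} g {r} q∣a q∣ag+xr = mk∣ᶜ λ k →
  ∣m+n∣m⇒∣n (subst (_ ∣_) (coeff-⊕ (scale a g) (0ℤ ∷ r) (suc k)) (∣coeff q∣ag+xr (suc k)))
            (∣coeff (∣ᶜ-scale q∣a g) (suc k))

module _ {q : ℕ} (q-prime : Prime q) where

  ∣-*-prime : ∀ a b → + q ∣ a * b → (+ q ∣ a) ⊎ (+ q ∣ b)
  ∣-*-prime a b q∣ab = Sum.map ∣ᵤ⇒∣ ∣ᵤ⇒∣
    (euclidsLemma ∣ a ∣ ∣ b ∣ q-prime (subst (q ℕ.∣_) (ℤ.abs-* a b) (∣⇒∣ᵤ q∣ab)))

  ∤-head-∣ᶜ : ∀ {a} f → ¬ (+ q ∣ a) → ∀ g → q ∣ᶜ (a ∷ f) ⊗ g → q ∣ᶜ g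
  ∤-head-∣ᶜ f q∤a []      _ = ∣ᶜ-0ₚ
  ∤-head-∣ᶜ {a} f q∤a (b ∷ g) q∣fg with + q ∣? b
  ... | yes q∣b = ∣ᶜ-∷ q∣b (∤-head-∣ᶜ f q∤a g
                    (∣ᶜ-shift (a ∷ f) q∣b (∣ᶜ-resp-≋ (⊗-∷ (a ∷ f) b g) q∣fg)))
  ... | no  q∤b with ∣-*-prime a b (subst (+ q ∣_) (coeff-∷⊗-zero a f (b ∷ g)) (∣coeff q∣fg 0))
  ...   | inj₁ q∣a = contradiction q∣a q∤a
  ...   | inj₂ q∣b = contradiction q∣b q∤b

  gauss-lemma : ∀ f g → q ∣ᶜ f ⊗ g → q ∣ᶜ f ⊎ q ∣ᶜ g
  gauss-lemma []      g _    = inj₁ ∣ᶜ-0ₚ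
  gauss-lemma (a ∷ f) g q∣fg with + q ∣? a
  ... | yes q∣a = Sum.map₁ (∣ᶜ-∷ q∣a) (gauss-lemma f g (∣ᶜ-shift g q∣a q∣fg))
  ... | no  q∤a = inj₂ (∤-head-∣ᶜ f q∤a g q∣fg)

∣ᶜ⇒scale : ∀ {q} f → q ∣ᶜ f → ∃[ f′ ] f ≋ scale (+ q) f′
∣ᶜ⇒scale []      _   = [] , ≋-refl
∣ᶜ⇒scale {q} (a ∷ f) q∣af with ∣coeff q∣af 0 | ∣ᶜ⇒scale f (mk∣ᶜ λ k → ∣coeff q∣af (suc k))
... | divides a′ a≡a′q | f′ , f≋qf′ = a′ ∷ f′ , ∷-cong (trans a≡a′q (ℤ.*-comm a′ (+ q))) f≋qf′

scale-cancel : ∀ {c} → c ≢ 0ℤ → ∀ f g → scale c f ≋ scale c g → f ≋ g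
scale-cancel {c} c≢0 f g cf≋cg = mk≋ λ k → ℤ.*-cancelˡ-≡ c _ _ {{ℤ.≢-nonZero c≢0}}
  (trans (sym (coeff-scale c f k)) (trans (coeff-≡ cf≋cg k) (coeff-scale c g k)))

⊗-scaleʳ : ∀ a f g → f ⊗ scale a g ≋ scale a (f ⊗ g)
⊗-scaleʳ a f g = ≋-trans (⊗-comm f (scale a g)) (≋-trans (scale-⊗ a g f) (scale-cong a (⊗-comm g f)))

∣∣≡1⇒*-self : ∀ {c} → ∣ c ∣ ≡ 1 → c * c ≡ 1ℤ
∣∣≡1⇒*-self {+ 1}   _ = refl
∣∣≡1⇒*-self { -[1+ 0 ] } _ = refl

scale-involutive : ∀ c → ∣ c ∣ ≡ 1 → ∀ f → scale c (scale c f) ≋ f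
scale-involutive c ∣c∣≡1 f = ≋-trans (scale-assoc c c f)
  (≋-trans (≡⇒≋ (cong (λ d → scale d f) (∣∣≡1⇒*-self {c} ∣c∣≡1))) (scale-identityˡ f))

≢0⇒∣∣≢0 : ∀ {c} → c ≢ 0ℤ → ∣ c ∣ ≢ 0
≢0⇒∣∣≢0 c≢0 ∣c∣≡0 = c≢0 (ℤ.∣i∣≡0⇒i≡0 ∣c∣≡0)

≢0∧≢1⇒2≤∣∣ : ∀ {c} → c ≢ 0ℤ → ∣ c ∣ ≢ 1 → 2 ≤ ∣ c ∣
≢0∧≢1⇒2≤∣∣ c≢0 ∣c∣≢1 = ℕ.≤∧≢⇒< (ℕ.n≢0⇒n>0 (≢0⇒∣∣≢0 c≢0)) (≢-sym ∣c∣≢1)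

-- Dividing the content c out of g ⊗ h ≋ c u.
record Splitting (u g h : ℤ[X]) : Set where
  constructor mkSplitting
  field
    {a b}  : ℤ
    {g′ h′} : ℤ[X]
    a≢0    : a ≢ 0ℤ
    b≢0    : b ≢ 0ℤ
    g≋ag′  : g ≋ scale a g′
    h≋bh′  : h ≋ scale b h′
    u≋g′h′ : u ≋ g′ ⊗ h′

Splitting-scaleˡ : ∀ {u g h a g₁} → a ≢ 0ℤ → g ≋ scale a g₁ → Splitting u g₁ h → Splitting u g h
Splitting-scaleˡ {a = a} a≢0 g≋ag₁ (mkSplitting {a₁} {g′ = g′} a₁≢0 b≢0 g₁≋a₁g′ h≋bh′ u≋g′h′) =
  mkSplitting {a = a * a₁} (*-≢0 a≢0 a₁≢0) b≢0
    (≋-trans g≋ag₁ (≋-trans (scale-cong a g₁≋a₁g′) (scale-assoc a a₁ g′))) h≋bh′ u≋g′h′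

Splitting-sym : ∀ {u g h} → Splitting u g h → Splitting u h g
Splitting-sym (mkSplitting {g′ = g′} {h′} a≢0 b≢0 g≋ag′ h≋bh′ u≋g′h′) =
  mkSplitting {g′ = h′} {g′} b≢0 a≢0 h≋bh′ g≋ag′ (≋-trans u≋g′h′ (⊗-comm g′ h′))

unit-Splitting : ∀ c {u g h} → ∣ c ∣ ≡ 1 → scale c u ≋ g ⊗ h → Splitting u g h
unit-Splitting c {u} {g} {h} ∣c∣≡1 cu≋gh = mkSplitting {a = c} {1ℤ} {scale c g} {h}
  c≢0 (λ ()) (≋-sym (scale-involutive c ∣c∣≡1 g)) (≋-sym (scale-identityˡ h)) u≋[cg]h
  where
  c≢0 : c ≢ 0ℤ
  c≢0 refl = ℕ.0≢1+n ∣c∣≡1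
  u≋[cg]h : u ≋ scale c g ⊗ h
  u≋[cg]h = begin
    u                     ≈⟨ scale-involutive c ∣c∣≡1 u ⟨
    scale c (scale c u)   ≈⟨ scale-cong c cu≋gh ⟩
    scale c (g ⊗ h)       ≈⟨ scale-⊗ c g h ⟨
    scale c g ⊗ h         ∎
    where open ≋-Reasoning

prime⇒+≢0 : ∀ {q} → Prime q → + q ≢ 0ℤ
prime⇒+≢0 {q} q-prime q≡0 = ℕ.≢-nonZero⁻¹ q {{prime⇒nonZero q-prime}} (ℤ.+-injective q≡0)

split-prime : ∀ {q} → Prime q → ∀ {c u g h} → scale (c * + q) u ≋ g ⊗ h →
              (∃[ g₁ ] g ≋ scale (+ q) g₁ × scale c u ≋ g₁ ⊗ h) ⊎
              (∃[ h₁ ] h ≋ scale (+ q) h₁ × scale c u ≋ g ⊗ h₁)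
split-prime {q} q-prime {c} {u} {g} {h} cqu≋gh =
  Sum.map divideˡ divideʳ (gauss-lemma q-prime g h (∣ᶜ-resp-≋ cqu≋gh (∣ᶜ-scale (∣n⇒∣m*n c ∣-refl) u)))
  where
  open ≋-Reasoning
  q≢0 = prime⇒+≢0 q-prime
  q[cu]≈gh : scale (+ q) (scale c u) ≋ g ⊗ h
  q[cu]≈gh = begin
    scale (+ q) (scale c u)   ≈⟨ scale-assoc (+ q) c u ⟩
    scale (+ q * c) u         ≡⟨ cong (λ d → scale d u) (ℤ.*-comm (+ q) c) ⟩
    scale (c * + q) u         ≈⟨ cqu≋gh ⟩
    g ⊗ h                     ∎
  divideˡ : q ∣ᶜ g → ∃[ g₁ ] g ≋ scale (+ q) g₁ × scale c u ≋ g₁ ⊗ h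
  divideˡ q∣g = let g₁ , g≋qg₁ = ∣ᶜ⇒scale g q∣g in
    g₁ , g≋qg₁ , scale-cancel q≢0 _ _ (begin
      scale (+ q) (scale c u)   ≈⟨ q[cu]≈gh ⟩
      g ⊗ h                     ≈⟨ ⊗-congʳ h g≋qg₁ ⟩
      scale (+ q) g₁ ⊗ h        ≈⟨ scale-⊗ (+ q) g₁ h ⟩
      scale (+ q) (g₁ ⊗ h)      ∎)
  divideʳ : q ∣ᶜ h → ∃[ h₁ ] h ≋ scale (+ q) h₁ × scale c u ≋ g ⊗ h₁
  divideʳ q∣h = let h₁ , h≋qh₁ = ∣ᶜ⇒scale h q∣h in
    h₁ , h≋qh₁ , scale-cancel q≢0 _ _ (begin
      scale (+ q) (scale c u)   ≈⟨ q[cu]≈gh ⟩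
      g ⊗ h                     ≈⟨ ⊗-congˡ g h≋qh₁ ⟩
      g ⊗ scale (+ q) h₁        ≈⟨ ⊗-scaleʳ (+ q) g h₁ ⟩
      scale (+ q) (g ⊗ h₁)      ∎)

split : ∀ {c} → c ≢ 0ℤ → ∀ {u g h} → scale c u ≋ g ⊗ h → Splitting u g h
split {c} c≢0 = split-≤ ∣ c ∣ ℕ.≤-refl c≢0
  where
  split-≤ : ∀ n {c} → ∣ c ∣ ≤ n → c ≢ 0ℤ → ∀ {u g h} → scale c u ≋ g ⊗ h → Splitting u g h
  split-≤ zero    ∣c∣≤0 c≢0 _ = contradiction (ℕ.n≤0⇒n≡0 ∣c∣≤0) (≢0⇒∣∣≢0 c≢0)
  split-≤ (suc n) {c} ∣c∣≤n c≢0 cu≋gh with ∣ c ∣ ℕ.≟ 1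
  ... | yes ∣c∣≡1 = unit-Splitting c ∣c∣≡1 cu≋gh
  ... | no  ∣c∣≢1 with prime-factor ∣ c ∣ (≢0∧≢1⇒2≤∣∣ c≢0 ∣c∣≢1)
  ...   | q , q-prime , q∣c with ∣ᵤ⇒∣ {+ q} {c} q∣c
  ...     | divides c′ refl =
    [ (λ (g₁ , g≋qg₁ , c′u≋g₁h) → Splitting-scaleˡ q≢0 g≋qg₁ (split-≤ n {c′} c′≤n c′≢0 c′u≋g₁h))
    , (λ (h₁ , h≋qh₁ , c′u≋gh₁) → Splitting-sym
         (Splitting-scaleˡ q≢0 h≋qh₁ (Splitting-sym (split-≤ n {c′} c′≤n c′≢0 c′u≋gh₁))))
    ]′ (split-prime q-prime {c′} cu≋gh)
    where
    q≢0 = prime⇒+≢0 q-prime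
    c′≢0 : c′ ≢ 0ℤ
    c′≢0 refl = c≢0 refl
    c′<c : ∣ c′ ∣ < ∣ c′ * + q ∣
    c′<c = subst (∣ c′ ∣ <_) (sym (ℤ.abs-* c′ (+ q)))
      (ℕ.m<m*n ∣ c′ ∣ q {{ℕ.≢-nonZero (≢0⇒∣∣≢0 c′≢0)}} (ℕ.nonTrivial⇒n>1 q {{prime⇒nonTrivial q-prime}}))
    c′≤n : ∣ c′ ∣ ≤ n
    c′≤n = ℕ.≤-pred (ℕ.<-≤-trans c′<c ∣c∣≤n)

Primitive : ℤ[X] → Set
Primitive f = ∀ {q} → Prime q → ¬ q ∣ᶜ f

Primitive-unit : ∀ {f a f′} → Primitive f → a ≢ 0ℤ → f ≋ scale a f′ → ∣ a ∣ ≡ 1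
Primitive-unit {f} {a} {f′} f-primitive a≢0 f≋af′ with ∣ a ∣ ℕ.≟ 1
... | yes ∣a∣≡1 = ∣a∣≡1
... | no  ∣a∣≢1 with prime-factor ∣ a ∣ (≢0∧≢1⇒2≤∣∣ a≢0 ∣a∣≢1)
...   | q , q-prime , q∣a =
  contradiction (∣ᶜ-resp-≋ (≋-sym f≋af′) (∣ᶜ-scale (∣ᵤ⇒∣ {+ q} {a} q∣a) f′)) (f-primitive q-prime)

Primitive-∣-scaled : ∀ {f c h k} → Primitive f → c ≢ 0ℤ → scale c h ≋ f ⊗ k → f ∣ₚ h
Primitive-∣-scaled {f} {h = h} f-primitive c≢0 ch≋fk with split c≢0 ch≋fk
... | mkSplitting {a} {g′ = f′} {k′} a≢0 _ f≋af′ _ h≋f′k′ = mk∣ₚ (scale a k′) (begin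
  h                     ≈⟨ h≋f′k′ ⟩
  f′ ⊗ k′               ≈⟨ ⊗-congʳ k′ f′≋af ⟩
  scale a f ⊗ k′        ≈⟨ scale-⊗ a f k′ ⟩
  scale a (f ⊗ k′)      ≈⟨ ⊗-scaleʳ a f k′ ⟨
  f ⊗ scale a k′        ∎)
  where
  open ≋-Reasoning
  f′≋af : f′ ≋ scale a f
  f′≋af = ≋-sym (≋-trans (scale-cong a f≋af′) (scale-involutive a (Primitive-unit f-primitive a≢0 f≋af′) f′))

∣ₚ-resp-≋ : ∀ {f g g′} → g ≋ g′ → f ∣ₚ g → f ∣ₚ g′
∣ₚ-resp-≋ g≋g′ (mk∣ₚ k g≋fk) = mk∣ₚ k (≋-trans (≋-sym g≋g′) g≋fk)

∣ₚ-remainder : ∀ {f u v d} (pd : PseudoDivision u v d) h →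
               f ∣ₚ u ⊗ h → f ∣ₚ v ⊗ h → f ∣ₚ PseudoDivision.rem pd ⊗ h
∣ₚ-remainder {f} {u} {v} (mkPseudoDivision {c} {q} {r} _ cu≋qv+r _) h (mk∣ₚ k₁ uh≋fk₁) (mk∣ₚ k₂ vh≋fk₂) =
  mk∣ₚ (constℤ c ⊗ k₁ ⊕ ⊝ (q ⊗ k₂)) (begin
  r ⊗ h                                              ≈⟨ ⊗-congʳ h (R≋[QV+R]-QV r (q ⊗ v)) ⟩
  ((q ⊗ v ⊕ r) ⊕ ⊝ (q ⊗ v)) ⊗ h                      ≈⟨ ⊗-congʳ h (⊕-congʳ (⊝ (q ⊗ v)) qv+r≋cu) ⟩
  (constℤ c ⊗ u ⊕ ⊝ (q ⊗ v)) ⊗ h                     ≈⟨ expand (constℤ c) u q v h ⟩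
  constℤ c ⊗ (u ⊗ h) ⊕ ⊝ (q ⊗ (v ⊗ h))               ≈⟨ ⊕-cong (⊗-congˡ (constℤ c) uh≋fk₁) (⊝-cong (⊗-congˡ q vh≋fk₂)) ⟩
  constℤ c ⊗ (f ⊗ k₁) ⊕ ⊝ (q ⊗ (f ⊗ k₂))             ≈⟨ factor (constℤ c) f k₁ q k₂ ⟩
  f ⊗ (constℤ c ⊗ k₁ ⊕ ⊝ (q ⊗ k₂))                   ∎)
  where
  open ≋-Reasoning
  qv+r≋cu : q ⊗ v ⊕ r ≋ constℤ c ⊗ u
  qv+r≋cu = ≋-trans (≋-sym cu≋qv+r) (scale-≋-constℤ⊗ c u)
  R≋[QV+R]-QV : ∀ R QV → R ≋ (QV ⊕ R) ⊕ ⊝ QV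
  R≋[QV+R]-QV = solve-∀ ℤ[X]-ring
  expand : ∀ C U Q V H → (C ⊗ U ⊕ ⊝ (Q ⊗ V)) ⊗ H ≋ C ⊗ (U ⊗ H) ⊕ ⊝ (Q ⊗ (V ⊗ H))
  expand = solve-∀ ℤ[X]-ring
  factor : ∀ C F K₁ Q K₂ → C ⊗ (F ⊗ K₁) ⊕ ⊝ (Q ⊗ (F ⊗ K₂)) ≋ F ⊗ (C ⊗ K₁ ⊕ ⊝ (Q ⊗ K₂))
  factor = solve-∀ ℤ[X]-ring

-- Eisenstein polynomials

-- The form of Eisenstein's criterion met by the tree polynomials: the constant term is P itself.
record Eisenstein (f : ℤ[X]) (n P : ℕ) : Set where
  field
    prime     : Prime P
    coeff₀    : coeffℤ f 0 ≡ + P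
    low-∣     : ∀ k → k < n → + P ∣ coeffℤ f k
    degree    : HasDegree f n
    leading-∤ : ¬ (+ P ∣ coeffℤ f n)

module _ {P : ℕ} (P-prime : Prime P) where

  ∣∧∣⇒*≢P : ∀ {a b} → + P ∣ a → + P ∣ b → a * b ≢ + P
  ∣∧∣⇒*≢P {a} {b} P∣a P∣b ab≡P = ℕ.<⇒≱ (ℕ.nonTrivial⇒n>1 P {{prime⇒nonTrivial P-prime}}) P≤1
    where
    instance _ = prime⇒nonZero P-prime
    P*P∣P : P ℕ.* P ℕ.∣ P
    P*P∣P = subst (P ℕ.* P ℕ.∣_) (trans (sym (ℤ.abs-* a b)) (cong ∣_∣ ab≡P))
                  (ℕ.*-pres-∣ (∣⇒∣ᵤ P∣a) (∣⇒∣ᵤ P∣b))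
    P≤1 : P ≤ 1
    P≤1 = ℕ.*-cancelˡ-≤ P (subst (P ℕ.* P ≤_) (sym (ℕ.*-identityʳ P)) (ℕ.∣⇒≤ P*P∣P))

  ∣-low-coeffs : ∀ {h} → ¬ (+ P ∣ coeffℤ h 0) → ∀ g N →
                 (∀ k → k < N → + P ∣ coeffℤ (g ⊗ h) k) → ∀ k → k < N → + P ∣ coeffℤ g k
  ∣-low-coeffs P∤h₀ [] N _ k _ = divides 0ℤ refl
  ∣-low-coeffs {h} P∤h₀ (a ∷ g) (suc N) P∣gh k k<N
    with ∣-*-prime P-prime a (coeffℤ h 0) (subst (+ P ∣_) (coeff-∷⊗-zero a g h) (P∣gh 0 (s≤s z≤n)))
  ... | inj₂ P∣h₀ = contradiction P∣h₀ P∤h₀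
  ... | inj₁ P∣a with k
  ...   | zero   = P∣a
  ...   | suc k′ = ∣-low-coeffs P∤h₀ g N P∣g′h k′ (ℕ.≤-pred k<N)
    where
    P∣g′h : ∀ k → k < N → + P ∣ coeffℤ (g ⊗ h) k
    P∣g′h k k<N = ∣m+n∣m⇒∣n (subst (+ P ∣_) (coeff-∷⊗-suc a g h k) (P∣gh (suc k) (s≤s k<N)))
                            (∣m⇒∣m*n (coeffℤ h (suc k)) P∣a)

module _ {f : ℤ[X]} {n P : ℕ} (E : Eisenstein f n P) where
  open Eisenstein E

  Eisenstein-1≤degree : 1 ≤ n
  Eisenstein-1≤degree with n ℕ.≟ 0
  ... | yes refl = contradiction (subst (+ P ∣_) (sym coeff₀) ∣-refl) leading-∤
  ... | no  n≢0  = ℕ.n≢0⇒n>0 n≢0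

  Eisenstein-primitive : Primitive f
  Eisenstein-primitive {q} q-prime q∣f with prime⇒irreducible prime (∣⇒∣ᵤ (subst (+ q ∣_) coeff₀ (∣coeff q∣f 0)))
  ... | inj₁ q≡1    = ℕ.nonTrivial⇒≢1 {{prime⇒nonTrivial q-prime}} q≡1
  ... | inj₂ refl   = leading-∤ (∣coeff q∣f n)

  private
    -- A factorisation with P ∤ h₀ and deg h ≥ 1 would put the leading coefficient of g, hence of f, in (P).
    ¬factor : ∀ {g h d e} → f ≋ g ⊗ h → HasDegree g d → HasDegree h (suc e) → ¬ (+ P ∣ coeffℤ h 0) → ⊥
    ¬factor {g} {h} {d} {e} f≋gh g°d h°e P∤h₀ = leading-∤ (subst (+ P ∣_) (sym fₙ≡gₐhₑ) (∣m⇒∣m*n _ P∣gₐ))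
      where
      n≡d+e : n ≡ d ℕ.+ suc e
      n≡d+e = HasDegree-unique degree (HasDegree-resp-≋ (≋-sym f≋gh) (HasDegree-⊗ g°d h°e))
      fₙ≡gₐhₑ : coeffℤ f n ≡ coeffℤ g d * coeffℤ h (suc e)
      fₙ≡gₐhₑ = trans (coeff-≡ f≋gh n)
        (subst (λ m → coeffℤ (g ⊗ h) m ≡ _) (sym n≡d+e) (coeff-⊗-top (below h°e) g d (below g°d)))
      P∣gₐ : + P ∣ coeffℤ g d
      P∣gₐ = ∣-low-coeffs prime P∤h₀ g n (λ k k<n → subst (+ P ∣_) (coeff-≡ f≋gh k) (low-∣ k k<n)) d
               (subst (d <_) (sym n≡d+e) (ℕ.m<m+n d (s≤s z≤n)))

  Eisenstein-irreducible : ∀ {g h} → f ≋ g ⊗ h → HasDegree g 0 ⊎ HasDegree h 0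
  Eisenstein-irreducible {g} {h} f≋gh with isZero⊎hasDegree g | isZero⊎hasDegree h
  ... | inj₁ g≋0 | _ = ⊥-elim (HasDegree⇒¬IsZero degree (≋-trans f≋gh (⊗-congʳ h g≋0)))
  ... | _ | inj₁ h≋0 = ⊥-elim (HasDegree⇒¬IsZero degree (≋-trans f≋gh (≋-trans (⊗-congˡ g h≋0) (⊗-zeroʳ g))))
  ... | inj₂ (zero , g°0) | _ = inj₁ g°0
  ... | _ | inj₂ (zero , h°0) = inj₂ h°0
  ... | inj₂ (suc d , g°d) | inj₂ (suc e , h°e) with + P ∣? coeffℤ h 0
  ...   | no  P∤h₀ = ⊥-elim (¬factor f≋gh g°d h°e P∤h₀)
  ...   | yes P∣h₀ = ⊥-elim (¬factor (≋-trans f≋gh (⊗-comm g h)) h°e g°d P∤g₀)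
    where
    P∤g₀ : ¬ (+ P ∣ coeffℤ g 0)
    P∤g₀ P∣g₀ = ∣∧∣⇒*≢P prime P∣g₀ P∣h₀
      (trans (sym (coeff-⊗-zero g h)) (trans (sym (coeff-≡ f≋gh 0)) coeff₀))

  Eisenstein-irreducible-scaled : ∀ {c g h} → c ≢ 0ℤ → scale c f ≋ g ⊗ h → HasDegree g 0 ⊎ HasDegree h 0
  Eisenstein-irreducible-scaled c≢0 cf≋gh with split c≢0 cf≋gh
  ... | mkSplitting a≢0 b≢0 g≋ag′ h≋bh′ f≋g′h′ = Sum.map
    (λ g′°0 → HasDegree-resp-≋ (≋-sym g≋ag′) (HasDegree-scale a≢0 g′°0))
    (λ h′°0 → HasDegree-resp-≋ (≋-sym h≋bh′) (HasDegree-scale b≢0 h′°0))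
    (Eisenstein-irreducible f≋g′h′)

  private
    ∣ₚ-0ₚ : f ∣ₚ 0ₚ
    ∣ₚ-0ₚ = mk∣ₚ 0ₚ (≋-sym (⊗-zeroʳ f))

    ∣ₚ-⊗ : ∀ h → f ∣ₚ f ⊗ h
    ∣ₚ-⊗ h = mk∣ₚ h ≋-refl

    ∣ₚ-small⇒≋0 : ∀ {r} → DegreeBelow r n → f ∣ₚ r → IsZero r
    ∣ₚ-small⇒≋0 r<n (mk∣ₚ s r≋fs) = DegreeBelow-multiple⇒IsZero degree s r≋fs r<n

    Prime-below : ℕ → Set
    Prime-below N = ∀ g → DegreeBelow g N → ∀ h → f ∣ₚ g ⊗ h → f ∣ₚ g ⊎ f ∣ₚ h

    -- deg g < n: from c f ≋ q g ⊕ r and f ∣ₚ r we get r ≋ 0, so g is a constant by irreducibility.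
    prime-low : ∀ {N g d} → Prime-below N → HasDegree g d → d ≤ N → d < n →
                ∀ h → f ∣ₚ g ⊗ h → f ∣ₚ g ⊎ f ∣ₚ h
    prime-low {g = g} {d} ih g°d d≤N d<n h f∣gh with pseudo-divide g°d (suc n) (below degree)
    ... | pd@(mkPseudoDivision {c} {q} {r} c≢0 cf≋qg+r r<d)
        with ih r (DegreeBelow-mono d≤N r<d) h (∣ₚ-remainder pd h (∣ₚ-⊗ h) f∣gh)
    ...   | inj₂ f∣h = inj₂ f∣h
    ...   | inj₁ f∣r = Sum.[ q-constant , g-constant ] (Eisenstein-irreducible-scaled c≢0 cf≋qg)
      where
      cf≋qg : scale c f ≋ q ⊗ g
      cf≋qg = ≋-trans cf≋qg+r (≋-trans (⊕-congˡ (q ⊗ g) r≋0) (⊕-identityʳ (q ⊗ g)))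
        where r≋0 = ∣ₚ-small⇒≋0 (DegreeBelow-mono (ℕ.<⇒≤ d<n) r<d) f∣r
      q-constant : HasDegree q 0 → f ∣ₚ g ⊎ f ∣ₚ h
      q-constant q°0 = ⊥-elim (ℕ.<⇒≢ d<n
        (HasDegree-unique (HasDegree-⊗ q°0 g°d) (HasDegree-resp-≋ cf≋qg (HasDegree-scale c≢0 degree))))
      g-constant : HasDegree g 0 → f ∣ₚ g ⊎ f ∣ₚ h
      g-constant g°0 = let mk∣ₚ k gh≋fk = f∣gh in
        inj₂ (Primitive-∣-scaled Eisenstein-primitive (leading≢0 g°0) (begin
          scale (coeffℤ g 0) h            ≈⟨ scale-≋-constℤ⊗ (coeffℤ g 0) h ⟩
          constℤ (coeffℤ g 0) ⊗ h         ≈⟨ ⊗-congʳ h (HasDegree-0⇒≋constℤ g°0) ⟨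
          g ⊗ h                           ≈⟨ gh≋fk ⟩
          f ⊗ k                           ∎))
        where open ≋-Reasoning

    -- deg g ≥ n: from c g ≋ q f ⊕ r and f ∣ₚ r we get c g ≋ q f.
    prime-high : ∀ {N g d} → Prime-below N → HasDegree g d → d ≤ N → n ≤ d →
                 ∀ h → f ∣ₚ g ⊗ h → f ∣ₚ g ⊎ f ∣ₚ h
    prime-high {g = g} {d} ih g°d d≤N n≤d h f∣gh with pseudo-divide degree (suc d) (below g°d)
    ... | pd@(mkPseudoDivision {c} {q} {r} c≢0 cg≋qf+r r<n)
        with ih r (DegreeBelow-mono (ℕ.≤-trans n≤d d≤N) r<n) h (∣ₚ-remainder pd h f∣gh (∣ₚ-⊗ h))
    ...   | inj₂ f∣h = inj₂ f∣h
    ...   | inj₁ f∣r = inj₁ (Primitive-∣-scaled Eisenstein-primitive c≢0 (begin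
      scale c g      ≈⟨ cg≋qf+r ⟩
      q ⊗ f ⊕ r      ≈⟨ ⊕-cong ≋-refl (∣ₚ-small⇒≋0 r<n f∣r) ⟩
      q ⊗ f ⊕ 0ₚ     ≈⟨ ⊕-identityʳ _ ⟩
      q ⊗ f          ≈⟨ ⊗-comm q f ⟩
      f ⊗ q          ∎))
      where open ≋-Reasoning

  Eisenstein-prime : ∀ g h → f ∣ₚ g ⊗ h → f ∣ₚ g ⊎ f ∣ₚ h
  Eisenstein-prime g = prime-below (length g) g (DegreeBelow-length g)
    where
    prime-below : ∀ N → Prime-below N
    prime-below zero    g g<0 h _ = inj₁ (∣ₚ-resp-≋ (≋-sym (DegreeBelow-zero g<0)) ∣ₚ-0ₚ)
    prime-below (suc N) g g<N h f∣gh with isZero⊎hasDegree g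
    ... | inj₁ g≋0       = inj₁ (∣ₚ-resp-≋ (≋-sym g≋0) ∣ₚ-0ₚ)
    ... | inj₂ (d , g°d) with d ℕ.<? n
    ...   | yes d<n = prime-low  (prime-below N) g°d (HasDegree⇒≤ g°d g<N) d<n h f∣gh
    ...   | no  d≮n = prime-high (prime-below N) g°d (HasDegree⇒≤ g°d g<N) (ℕ.≮⇒≥ d≮n) h f∣gh

Eisenstein-resp-≋ : ∀ {f g n P} → f ≋ g → Eisenstein f n P → Eisenstein g n P
Eisenstein-resp-≋ {n = n} {P} f≋g E = record
  { prime     = prime
  ; coeff₀    = trans (sym (coeff-≡ f≋g 0)) coeff₀
  ; low-∣     = λ k k<n → subst (+ P ∣_) (coeff-≡ f≋g k) (low-∣ k k<n)
  ; degree    = HasDegree-resp-≋ f≋g degree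
  ; leading-∤ = λ P∣gₙ → leading-∤ (subst (+ P ∣_) (sym (coeff-≡ f≋g n)) P∣gₙ)
  }
  where open Eisenstein E

-- Unique factorisation

⊗-commutativeMonoid : CommutativeMonoid _ _
⊗-commutativeMonoid = CommutativeRing.*-commutativeMonoid ℤ[X]-commutativeRing

open import Algebra.Properties.CommutativeMonoid.Sum ⊗-commutativeMonoid
  using (sum-remove; sum-permute; sum-cong-≋) renaming (sum to ∏)

IsEisenstein : ℤ[X] → Set
IsEisenstein f = ∃₂ (Eisenstein f)

1ₚ-degree : HasDegree 1ₚ 0
1ₚ-degree = mkHasDegree (λ ()) (mkDegreeBelow λ { (suc k) _ → refl })

module _ {f n P} (E : Eisenstein f n P) where
  open Eisenstein E

  Eisenstein-∤1ₚ : ¬ f ∣ₚ 1ₚ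
  Eisenstein-∤1ₚ (mk∣ₚ k 1≋fk) with isZero⊎hasDegree k
  ... | inj₁ k≋0       =
    contradiction (≋-trans 1≋fk (≋-trans (⊗-congˡ f k≋0) (⊗-zeroʳ f))) (HasDegree⇒¬IsZero 1ₚ-degree)
  ... | inj₂ (m , k°m) = ℕ.<⇒≢ (ℕ.≤-trans (Eisenstein-1≤degree E) (ℕ.m≤m+n n m))
                           (HasDegree-unique 1ₚ-degree (HasDegree-resp-≋ (≋-sym 1≋fk) (HasDegree-⊗ degree k°m)))

  Eisenstein-∣-∏ : ∀ {m} (gs : Vector ℤ[X] m) → f ∣ₚ ∏ gs → ∃[ j ] f ∣ₚ gs j
  Eisenstein-∣-∏ {zero}  gs f∣1 = contradiction f∣1 Eisenstein-∤1ₚ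
  Eisenstein-∣-∏ {suc m} gs f∣∏ with Eisenstein-prime E (gs zero) (∏ (gs ∘ suc)) f∣∏
  ... | inj₁ f∣g₀ = zero , f∣g₀
  ... | inj₂ f∣∏′ = Product.map suc id (Eisenstein-∣-∏ (gs ∘ suc) f∣∏′)

  -- Comparing constant terms in g ≋ f ⊗ s₀ gives P′ = P s₀ with P, P′ prime, so s₀ = 1.
  Eisenstein-∣⇒≋ : ∀ {g n′ P′} → Eisenstein g n′ P′ → f ∣ₚ g → g ≋ f
  Eisenstein-∣⇒≋ {g} {P′ = P′} E′ (mk∣ₚ s g≋fs) with Eisenstein-irreducible E′ g≋fs
  ... | inj₁ f°0 = ⊥-elim (ℕ.<⇒≢ (Eisenstein-1≤degree E) (sym (HasDegree-unique degree f°0)))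
  ... | inj₂ s°0 = begin
    g                    ≈⟨ g≋fs ⟩
    f ⊗ s                ≈⟨ ⊗-congˡ f (HasDegree-0⇒≋constℤ s°0) ⟩
    f ⊗ constℤ s₀        ≡⟨ cong (λ c → f ⊗ constℤ c) s₀≡1 ⟩
    f ⊗ 1ₚ               ≈⟨ ⊗-comm f 1ₚ ⟩
    1ₚ ⊗ f               ≈⟨ ⊗-identityˡ f ⟩
    f                    ∎
    where
    open ≋-Reasoning
    s₀ = coeffℤ s 0
    P′≡Ps₀ : + P′ ≡ + P * s₀
    P′≡Ps₀ = trans (sym (Eisenstein.coeff₀ E′))
      (trans (coeff-≡ g≋fs 0) (trans (coeff-⊗-zero f s) (cong (_* s₀) coeff₀)))
    P≡P′ : P ≡ P′
    P≡P′ with prime⇒irreducible (Eisenstein.prime E′) (∣⇒∣ᵤ (divides s₀ (trans P′≡Ps₀ (ℤ.*-comm (+ P) s₀))))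
    ... | inj₁ P≡1  = contradiction P≡1 (ℕ.nonTrivial⇒≢1 {{prime⇒nonTrivial prime}})
    ... | inj₂ P≡P′ = P≡P′
    s₀≡1 : s₀ ≡ 1ℤ
    s₀≡1 = ℤ.*-cancelˡ-≡ (+ P) s₀ 1ℤ {{prime⇒nonZero prime}}
      (trans (sym P′≡Ps₀) (trans (cong +_ (sym P≡P′)) (sym (ℤ.*-identityʳ (+ P)))))

unique-factorisation : ∀ {m n} (fs : Vector ℤ[X] m) (gs : Vector ℤ[X] n) →
                       (∀ i → IsEisenstein (fs i)) → (∀ j → IsEisenstein (gs j)) →
                       ∏ fs ≋ ∏ gs → ∃[ σ ] ∀ i → fs i ≋ gs (σ ⟨$⟩ʳ i)
unique-factorisation {zero}  {zero}  fs gs _ _ _ = Perm.id , λ ()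
unique-factorisation {zero}  {suc n} fs gs _ gs-E 1≋∏gs with gs-E zero
... | _ , _ , E = contradiction (mk∣ₚ (∏ (gs ∘ suc)) 1≋∏gs) (Eisenstein-∤1ₚ E)
unique-factorisation {suc m} {zero}  fs gs fs-E _ ∏fs≋1 with fs-E zero
... | _ , _ , E = contradiction (mk∣ₚ (∏ (fs ∘ suc)) (≋-sym ∏fs≋1)) (Eisenstein-∤1ₚ E)
unique-factorisation {suc m} {suc n} fs gs fs-E gs-E ∏fs≋∏gs with fs-E zero
... | _ , _ , E with Eisenstein-∣-∏ E gs (mk∣ₚ (∏ (fs ∘ suc)) (≋-sym ∏fs≋∏gs))
...   | j , f₀∣gⱼ with gs-E j
...     | _ , _ , Eⱼ = Product.map (Perm.insert zero j) extend
  (unique-factorisation (fs ∘ suc) (removeAt gs j) (fs-E ∘ suc) (gs-E ∘ punchIn j) ∏fs′≋∏gs′)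
  where
  gⱼ≋f₀ : gs j ≋ fs zero
  gⱼ≋f₀ = Eisenstein-∣⇒≋ E Eⱼ f₀∣gⱼ
  ∏fs′≋∏gs′ : ∏ (fs ∘ suc) ≋ ∏ (removeAt gs j)
  ∏fs′≋∏gs′ = ⊗-cancelˡ (Eisenstein.degree E) _ _ (begin
    fs zero ⊗ ∏ (fs ∘ suc)            ≈⟨ ∏fs≋∏gs ⟩
    ∏ gs                              ≈⟨ sum-remove gs ⟩
    gs j ⊗ ∏ (removeAt gs j)          ≈⟨ ⊗-congʳ _ gⱼ≋f₀ ⟩
    fs zero ⊗ ∏ (removeAt gs j)       ∎)
    where open ≋-Reasoning
  extend : ∀ {σ} → (∀ i → fs (suc i) ≋ removeAt gs j (σ ⟨$⟩ʳ i)) →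
           ∀ i → fs i ≋ gs (Perm.insert zero j σ ⟨$⟩ʳ i)
  extend             _          zero    = ≋-sym gⱼ≋f₀
  extend {σ} fs′≋gs′σ (suc i) = ≋-trans (fs′≋gs′σ i) (≡⇒≋ (cong gs (sym (Perm.insert-punchIn zero j σ i))))

-- The polynomials C T

⟦_⟧ : Poly → ℤ[X]
⟦_⟧ = map (ℤ.+_)

⟦⟧-+P : ∀ f g → ⟦ f +P g ⟧ ≡ ⟦ f ⟧ ⊕ ⟦ g ⟧
⟦⟧-+P []      g       = refl
⟦⟧-+P (a ∷ f) []      = refl
⟦⟧-+P (a ∷ f) (b ∷ g) = cong₂ _∷_ (ℤ.pos-+ a b) (⟦⟧-+P f g)

⟦⟧-scaleP : ∀ a f → ⟦ scaleP a f ⟧ ≡ scale (+ a) ⟦ f ⟧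
⟦⟧-scaleP a []      = refl
⟦⟧-scaleP a (b ∷ f) = cong₂ _∷_ (ℤ.pos-* a b) (⟦⟧-scaleP a f)

⟦⟧-*P : ∀ f g → ⟦ f *P g ⟧ ≡ ⟦ f ⟧ ⊗ ⟦ g ⟧
⟦⟧-*P []      g = refl
⟦⟧-*P (a ∷ f) g =
  trans (⟦⟧-+P (scaleP a g) (0 ∷ f *P g)) (cong₂ _⊕_ (⟦⟧-scaleP a g) (cong (0ℤ ∷_) (⟦⟧-*P f g)))

⟦⟧-X^ : ∀ n → ⟦ X^ n ⟧ ≡ xⁿ n
⟦⟧-X^ zero    = refl
⟦⟧-X^ (suc n) = cong (0ℤ ∷_) (⟦⟧-X^ n)

coeff-⟦⟧ : ∀ f k → coeffℤ ⟦ f ⟧ k ≡ + coeff f k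
coeff-⟦⟧ []      k       = refl
coeff-⟦⟧ (a ∷ f) zero    = refl
coeff-⟦⟧ (a ∷ f) (suc k) = coeff-⟦⟧ f k

≈P⇒≋ : ∀ {f g} → f ≈P g → ⟦ f ⟧ ≋ ⟦ g ⟧
≈P⇒≋ {f} {g} f≈g = mk≋ λ k → trans (coeff-⟦⟧ f k) (trans (cong +_ (f≈g k)) (sym (coeff-⟦⟧ g k)))

≋⇒≈P : ∀ {f g} → ⟦ f ⟧ ≋ ⟦ g ⟧ → f ≈P g
≋⇒≈P {f} {g} f≋g k = ℤ.+-injective (trans (sym (coeff-⟦⟧ f k)) (trans (coeff-≡ f≋g k) (coeff-⟦⟧ g k)))

coeff-xⁿ-≡ : ∀ n → coeffℤ (xⁿ n) n ≡ 1ℤ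
coeff-xⁿ-≡ zero    = refl
coeff-xⁿ-≡ (suc n) = coeff-xⁿ-≡ n

coeff-xⁿ-≢ : ∀ n k → k ≢ n → coeffℤ (xⁿ n) k ≡ 0ℤ
coeff-xⁿ-≢ zero    zero    k≢n = contradiction refl k≢n
coeff-xⁿ-≢ zero    (suc k) _   = refl
coeff-xⁿ-≢ (suc n) zero    _   = refl
coeff-xⁿ-≢ (suc n) (suc k) k≢n = coeff-xⁿ-≢ n k (k≢n ∘ cong suc)

-- P + x (xᵐ + P Π), that is x^(m+1) + P x Π + P.
nodePoly : ℕ → ℕ → ℤ[X] → ℤ[X]
nodePoly P m Π = + P ∷ (xⁿ m ⊕ scale (+ P) Π)

coeff-nodePoly : ∀ P m Π k → coeffℤ (nodePoly P m Π) (suc k) ≡ coeffℤ (xⁿ m) k + + P * coeffℤ Π k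
coeff-nodePoly P m Π k =
  trans (coeff-⊕ (xⁿ m) (scale (+ P) Π) k) (cong (λ x → coeffℤ (xⁿ m) k + x) (coeff-scale (+ P) Π k))

nodePoly-cong : ∀ P m {Π Π′} → Π ≋ Π′ → nodePoly P m Π ≋ nodePoly P m Π′
nodePoly-cong P m Π≋Π′ = ∷-cong refl (⊕-cong ≋-refl (scale-cong (+ P) Π≋Π′))

nodePoly-cancel : ∀ {P m Π Π′} → Prime P → nodePoly P m Π ≋ nodePoly P m Π′ → Π ≋ Π′
nodePoly-cancel {P} {m} {Π} {Π′} P-prime e =
  scale-cancel (prime⇒+≢0 P-prime) Π Π′ (⊕-cancelˡ (xⁿ m) (∷-injectiveʳ e))

nodePoly-Eisenstein : ∀ {P m Π} → Prime P → DegreeBelow Π (suc m) → Eisenstein (nodePoly P m Π) (suc m) P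
nodePoly-Eisenstein {P} {m} {Π} P-prime Π<m = record
  { prime     = P-prime
  ; coeff₀    = refl
  ; low-∣     = low-∣
  ; degree    = mkHasDegree (λ lead≡0 → P∤lead (subst (+ P ∣_) (sym lead≡0) (divides 0ℤ refl))) (mkDegreeBelow vanish)
  ; leading-∤ = P∤lead
  }
  where
  P∣P*x : ∀ x → + P ∣ + P * x
  P∣P*x x = ∣m⇒∣m*n x ∣-refl
  lead≡ : coeffℤ (nodePoly P m Π) (suc m) ≡ 1ℤ + + P * coeffℤ Π m
  lead≡ = trans (coeff-nodePoly P m Π m) (cong (λ x → x + + P * coeffℤ Π m) (coeff-xⁿ-≡ m))
  P∤lead : ¬ (+ P ∣ coeffℤ (nodePoly P m Π) (suc m))
  P∤lead P∣lead = ℕ.nonTrivial⇒≢1 {{prime⇒nonTrivial P-prime}}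
    (ℕ.∣1⇒≡1 (∣⇒∣ᵤ (∣m+n∣n⇒∣m {m = 1ℤ} (subst (+ P ∣_) lead≡ P∣lead) (P∣P*x (coeffℤ Π m)))))
  low-∣ : ∀ k → k < suc m → + P ∣ coeffℤ (nodePoly P m Π) k
  low-∣ zero    _         = ∣-refl
  low-∣ (suc k) (s≤s k<m) = subst (+ P ∣_) (sym (begin
    coeffℤ (nodePoly P m Π) (suc k)       ≡⟨ coeff-nodePoly P m Π k ⟩
    coeffℤ (xⁿ m) k + + P * coeffℤ Π k    ≡⟨ cong (λ x → x + + P * coeffℤ Π k) (coeff-xⁿ-≢ m k (ℕ.<⇒≢ k<m)) ⟩
    0ℤ + + P * coeffℤ Π k                 ≡⟨ ℤ.+-identityˡ _ ⟩
    + P * coeffℤ Π k                      ∎)) (P∣P*x (coeffℤ Π k))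
    where open ≡-Reasoning
  vanish : ∀ k → suc (suc m) ≤ k → coeffℤ (nodePoly P m Π) k ≡ 0ℤ
  vanish (suc k) (s≤s m<k) = begin
    coeffℤ (nodePoly P m Π) (suc k)       ≡⟨ coeff-nodePoly P m Π k ⟩
    coeffℤ (xⁿ m) k + + P * coeffℤ Π k    ≡⟨ cong₂ (λ x y → x + + P * y) (coeff-xⁿ-≢ m k (≢-sym (ℕ.<⇒≢ m<k)))
                                                                           (vanishes Π<m k m<k) ⟩
    0ℤ + + P * 0ℤ                         ≡⟨ ℤ.+-identityˡ (+ P * 0ℤ) ⟩
    + P * 0ℤ                              ≡⟨ ℤ.*-zeroʳ (+ P) ⟩
    0ℤ                                    ∎
    where open ≡-Reasoning

⟦C⟧-leaf : ∀ ℓ h → ⟦ C (node ℓ h []) ⟧ ≡ nodePoly (p ℓ) 0 0ₚ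
⟦C⟧-leaf ℓ h = refl

⟦C⟧-node : ∀ ℓ h t ts → ⟦ C (node ℓ h (t ∷ ts)) ⟧ ≋ nodePoly (p ℓ) (sizes (t ∷ ts)) ⟦ prodC (t ∷ ts) ⟧
⟦C⟧-node ℓ h t ts = begin
  ⟦ X^ (suc m) +P constP P *P X *P prodC (t ∷ ts) +P constP P ⟧
    ≡⟨ ⟦⟧-+P (X^ (suc m) +P constP P *P X *P prodC (t ∷ ts)) (constP P) ⟩
  ⟦ X^ (suc m) +P constP P *P X *P prodC (t ∷ ts) ⟧ ⊕ constℤ (+ P)
    ≡⟨ cong (_⊕ constℤ (+ P)) (⟦⟧-+P (X^ (suc m)) (constP P *P X *P prodC (t ∷ ts))) ⟩
  ⟦ X^ (suc m) ⟧ ⊕ ⟦ constP P *P X *P prodC (t ∷ ts) ⟧ ⊕ constℤ (+ P)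
    ≡⟨ cong₂ (λ A B → A ⊕ B ⊕ constℤ (+ P)) (⟦⟧-X^ (suc m))
             (trans (⟦⟧-*P (constP P *P X) (prodC (t ∷ ts))) (cong (_⊗ Π) (⟦⟧-*P (constP P) X))) ⟩
  xⁿ (suc m) ⊕ constℤ (+ P) ⊗ xⁿ 1 ⊗ Π ⊕ constℤ (+ P)
    ≈⟨ ⊕-congʳ (constℤ (+ P)) (⊕-congˡ (xⁿ (suc m)) (x-shift (constℤ (+ P)) Π)) ⟩
  (0ℤ ∷ xⁿ m) ⊕ (0ℤ ∷ constℤ (+ P) ⊗ Π) ⊕ constℤ (+ P)
    ≈⟨ ∷-cong refl (⊕-identityʳ _) ⟩
  + P ∷ (xⁿ m ⊕ constℤ (+ P) ⊗ Π)
    ≈⟨ ∷-cong refl (⊕-congˡ (xⁿ m) (≋-sym (scale-≋-constℤ⊗ (+ P) Π))) ⟩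
  nodePoly P m Π ∎
  where
  open ≋-Reasoning
  P = p ℓ
  m = sizes (t ∷ ts)
  Π = ⟦ prodC (t ∷ ts) ⟧
  x-shift : ∀ c f → c ⊗ xⁿ 1 ⊗ f ≋ 0ℤ ∷ c ⊗ f
  x-shift c f = begin
    c ⊗ xⁿ 1 ⊗ f          ≈⟨ swap c (xⁿ 1) f ⟩
    (0ℤ ∷ 1ₚ) ⊗ (c ⊗ f)   ≈⟨ 0∷-⊗ 1ₚ (c ⊗ f) ⟩
    0ℤ ∷ 1ₚ ⊗ (c ⊗ f)     ≈⟨ ∷-cong refl (⊗-identityˡ (c ⊗ f)) ⟩
    0ℤ ∷ c ⊗ f            ∎
    where
    swap : ∀ c x f → c ⊗ x ⊗ f ≋ x ⊗ (c ⊗ f)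
    swap = solve-∀ ℤ[X]-ring

mutual
  C-Eisenstein : ∀ T → Eisenstein ⟦ C T ⟧ (size T) (p (label T))
  C-Eisenstein (node ℓ h [])       = Eisenstein-resp-≋ (≡⇒≋ (sym (⟦C⟧-leaf ℓ h)))
    (nodePoly-Eisenstein (p-prime ℓ) (IsZero⇒DegreeBelow ≋-refl 1))
  C-Eisenstein (node ℓ h (t ∷ ts)) = Eisenstein-resp-≋ (≋-sym (⟦C⟧-node ℓ h t ts))
    (nodePoly-Eisenstein (p-prime ℓ) (below (prodC-degree (t ∷ ts))))

  prodC-degree : ∀ ts → HasDegree ⟦ prodC ts ⟧ (sizes ts)
  prodC-degree []       = 1ₚ-degree
  prodC-degree (t ∷ ts) = HasDegree-resp-≋ (≡⇒≋ (sym (⟦⟧-*P (C t) (prodC ts))))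
    (HasDegree-⊗ (Eisenstein.degree (C-Eisenstein t)) (prodC-degree ts))

⟦prodC⟧-∏ : ∀ ts → ⟦ prodC ts ⟧ ≋ ∏ (λ i → ⟦ C (lookup ts i) ⟧)
⟦prodC⟧-∏ []       = ≋-refl
⟦prodC⟧-∏ (t ∷ ts) = ≋-trans (≡⇒≋ (⟦⟧-*P (C t) (prodC ts))) (⊗-congˡ ⟦ C t ⟧ (⟦prodC⟧-∏ ts))

-- Reordering children

infix 4 _≅_

data _≅_ : Tree → Tree → Set where
  node≅ : ∀ {ℓ h h′ ts ts′} (σ : Permutation (length ts) (length ts′)) →
          (∀ i → lookup ts i ≅ lookup ts′ (σ ⟨$⟩ʳ i)) → node ℓ h ts ≅ node ℓ h′ ts′

⟦C⟧-node-cong : ∀ ℓ h h′ t ts t′ ts′ → ⟦ prodC (t ∷ ts) ⟧ ≋ ⟦ prodC (t′ ∷ ts′) ⟧ →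
                ⟦ C (node ℓ h (t ∷ ts)) ⟧ ≋ ⟦ C (node ℓ h′ (t′ ∷ ts′)) ⟧
⟦C⟧-node-cong ℓ h h′ t ts t′ ts′ Π≋Π′ = begin
  ⟦ C (node ℓ h (t ∷ ts)) ⟧                               ≈⟨ ⟦C⟧-node ℓ h t ts ⟩
  nodePoly (p ℓ) (sizes (t ∷ ts)) ⟦ prodC (t ∷ ts) ⟧      ≈⟨ nodePoly-cong (p ℓ) (sizes (t ∷ ts)) Π≋Π′ ⟩
  nodePoly (p ℓ) (sizes (t ∷ ts)) ⟦ prodC (t′ ∷ ts′) ⟧    ≡⟨ cong (λ m → nodePoly (p ℓ) m Π′) sizes≡ ⟩
  nodePoly (p ℓ) (sizes (t′ ∷ ts′)) ⟦ prodC (t′ ∷ ts′) ⟧  ≈⟨ ⟦C⟧-node ℓ h′ t′ ts′ ⟨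
  ⟦ C (node ℓ h′ (t′ ∷ ts′)) ⟧                            ∎
  where
  open ≋-Reasoning
  Π′ = ⟦ prodC (t′ ∷ ts′) ⟧
  sizes≡ : sizes (t ∷ ts) ≡ sizes (t′ ∷ ts′)
  sizes≡ = HasDegree-unique (prodC-degree (t ∷ ts)) (HasDegree-resp-≋ (≋-sym Π≋Π′) (prodC-degree (t′ ∷ ts′)))

C-resp-≅ : ∀ {T T′} → T ≅ T′ → ⟦ C T ⟧ ≋ ⟦ C T′ ⟧
C-resp-≅ (node≅ {ts = []}     {[]}       σ _)   = ≋-refl
C-resp-≅ (node≅ {ts = []}     {_ ∷ _}    σ _)   with σ ⟨$⟩ˡ zero
... | ()
C-resp-≅ (node≅ {ts = _ ∷ _}  {[]}       σ _)   with σ ⟨$⟩ʳ zero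
... | ()
C-resp-≅ (node≅ {ℓ} {h} {h′} {t ∷ ts} {t′ ∷ ts′} σ sub) = ⟦C⟧-node-cong ℓ h h′ t ts t′ ts′ (begin
  ⟦ prodC (t ∷ ts) ⟧                             ≈⟨ ⟦prodC⟧-∏ (t ∷ ts) ⟩
  ∏ (λ i → ⟦ C (lookup (t ∷ ts) i) ⟧)            ≈⟨ sum-cong-≋ (λ i → C-resp-≅ (sub i)) ⟩
  ∏ (λ i → ⟦ C (lookup (t′ ∷ ts′) (σ ⟨$⟩ʳ i)) ⟧) ≈⟨ sum-permute (λ j → ⟦ C (lookup (t′ ∷ ts′) j) ⟧) σ ⟨
  ∏ (λ j → ⟦ C (lookup (t′ ∷ ts′) j) ⟧)          ≈⟨ ⟦prodC⟧-∏ (t′ ∷ ts′) ⟨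
  ⟦ prodC (t′ ∷ ts′) ⟧                           ∎)
  where open ≋-Reasoning

C-determines-label : ∀ T T′ → ⟦ C T ⟧ ≋ ⟦ C T′ ⟧ → label T ≡ label T′
C-determines-label T@(node ℓ h _) T′@(node ℓ′ h′ _) CT≋CT′ = p-injective h h′ (ℤ.+-injective
  (trans (sym (Eisenstein.coeff₀ (C-Eisenstein T))) (trans (coeff-≡ CT≋CT′ 0) (Eisenstein.coeff₀ (C-Eisenstein T′)))))

C-determines-size : ∀ T T′ → ⟦ C T ⟧ ≋ ⟦ C T′ ⟧ → size T ≡ size T′
C-determines-size T T′ CT≋CT′ = HasDegree-unique (Eisenstein.degree (C-Eisenstein T))
  (HasDegree-resp-≋ (≋-sym CT≋CT′) (Eisenstein.degree (C-Eisenstein T′)))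

mutual
  C-injective : ∀ T T′ → ⟦ C T ⟧ ≋ ⟦ C T′ ⟧ → T ≅ T′
  C-injective T@(node ℓ h ts) T′@(node ℓ′ h′ ts′) CT≋CT′
    with C-determines-label T T′ CT≋CT′ | C-determines-size T T′ CT≋CT′
  C-injective (node ℓ h [])       (node ℓ h′ [])                  _ | refl | _ = node≅ Perm.id (λ ())
  C-injective (node ℓ h [])       (node ℓ h′ (node _ _ _ ∷ _))    _ | refl | ()
  C-injective (node ℓ h (node _ _ _ ∷ _)) (node ℓ h′ [])          _ | refl | ()
  C-injective (node ℓ h (t ∷ ts)) (node ℓ h′ (t′ ∷ ts′)) CT≋CT′ | refl | size≡ =
    match (unique-factorisation Cs Cs′ (λ i → _ , _ , C-Eisenstein (lookup (t ∷ ts) i))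
                                       (λ j → _ , _ , C-Eisenstein (lookup (t′ ∷ ts′) j)) ∏Cs≋∏Cs′)
    where
    open ≋-Reasoning
    Cs : Fin (length (t ∷ ts)) → ℤ[X]
    Cs i = ⟦ C (lookup (t ∷ ts) i) ⟧
    Cs′ : Fin (length (t′ ∷ ts′)) → ℤ[X]
    Cs′ j = ⟦ C (lookup (t′ ∷ ts′) j) ⟧
    P = p ℓ
    m = sizes (t ∷ ts)
    Π′ = ⟦ prodC (t′ ∷ ts′) ⟧
    ∏Cs≋∏Cs′ : ∏ Cs ≋ ∏ Cs′
    ∏Cs≋∏Cs′ = begin
      ∏ Cs                           ≈⟨ ⟦prodC⟧-∏ (t ∷ ts) ⟨
      ⟦ prodC (t ∷ ts) ⟧             ≈⟨ nodePoly-cancel (p-prime ℓ) (begin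
        nodePoly P m ⟦ prodC (t ∷ ts) ⟧    ≈⟨ ⟦C⟧-node ℓ h t ts ⟨
        ⟦ C (node ℓ h (t ∷ ts)) ⟧          ≈⟨ CT≋CT′ ⟩
        ⟦ C (node ℓ h′ (t′ ∷ ts′)) ⟧       ≈⟨ ⟦C⟧-node ℓ h′ t′ ts′ ⟩
        nodePoly P (sizes (t′ ∷ ts′)) Π′   ≡⟨ cong (λ n → nodePoly P n Π′) (ℕ.suc-injective size≡) ⟨
        nodePoly P m Π′                    ∎) ⟩
      Π′                             ≈⟨ ⟦prodC⟧-∏ (t′ ∷ ts′) ⟩
      ∏ Cs′                          ∎
    match : (∃[ σ ] ∀ i → Cs i ≋ Cs′ (σ ⟨$⟩ʳ i)) → node ℓ h (t ∷ ts) ≅ node ℓ h′ (t′ ∷ ts′)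
    match (σ , Cs≋Cs′σ) = node≅ σ (λ i → C-injective-lookup t ts i _ (Cs≋Cs′σ i))

  C-injective-lookup : ∀ t ts i T′ → ⟦ C (lookup (t ∷ ts) i) ⟧ ≋ ⟦ C T′ ⟧ → lookup (t ∷ ts) i ≅ T′
  C-injective-lookup t ts        zero    = C-injective t
  C-injective-lookup t (u ∷ ts) (suc i) = C-injective-lookup u ts i

-- Graph isomorphisms

¬⋖here : ∀ {t} {u : Pos t} → ¬ u ⋖ here
¬⋖here ()

⋖-asym : ∀ {t} {u v : Pos t} → u ⋖ v → ¬ v ⋖ u
⋖-asym (down i u⋖v) (down .i v⋖u) = ⋖-asym u⋖v v⋖u

⋖-parent-unique : ∀ {t} {u u′ v : Pos t} → u ⋖ v → u′ ⋖ v → u ≡ u′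
⋖-parent-unique (top i)      (top .i)       = refl
⋖-parent-unique (top i)      (down .i u′⋖)  = contradiction u′⋖ ¬⋖here
⋖-parent-unique (down i u⋖)  (top .i)       = contradiction u⋖ ¬⋖here
⋖-parent-unique (down i u⋖v) (down .i u′⋖v) = cong (child i) (⋖-parent-unique u⋖v u′⋖v)

root⊎parent : ∀ {t} (v : Pos t) → v ≡ here ⊎ ∃[ u ] u ⋖ v
root⊎parent here        = inj₁ refl
root⊎parent (child i v) with root⊎parent v
... | inj₁ refl         = inj₂ (here , top i)
... | inj₂ (u , u⋖v)    = inj₂ (child i u , down i u⋖v)

⋖-induction : ∀ {t} (P : Pos t → Set) → P here → (∀ {u v} → u ⋖ v → P u → P v) → ∀ v → P v
⋖-induction P P-here P-step here = P-here
⋖-induction {node ℓ h ts} P P-here P-step (child i v) =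
  ⋖-induction (λ w → P (child i w)) (P-step (top i) P-here) (λ u⋖v → P-step (down i u⋖v)) v

record ParentIso (T T′ : Tree) : Set where
  field
    bij : Pos T ↔ Pos T′
  open Inverse bij public using (to; from; strictlyInverseˡ; strictlyInverseʳ)
  field
    to-here  : to here ≡ here
    to-label : ∀ v → labelAt (to v) ≡ labelAt v
    to-⋖     : ∀ {u v} → u ⋖ v → to u ⋖ to v
    to-⋖⁻    : ∀ {u v} → to u ⋖ to v → u ⋖ v

ParentIso⇒RLIso : ∀ {T T′} → ParentIso T T′ → RLIso T T′
ParentIso⇒RLIso φ = record
  { bij       = bij
  ; rootPres  = to-here
  ; labelPres = to-label
  ; adjPres   = λ u v → mk⇔ (Sum.map to-⋖ to-⋖) (Sum.map to-⋖⁻ to-⋖⁻)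
  }
  where open ParentIso φ

module _ {T T′ : Tree} (φ : RLIso T T′) where
  open RLIso φ
  open Inverse bij using (from; strictlyInverseʳ)

  private
    to-injective : ∀ {u v} → to u ≡ to v → u ≡ v
    to-injective {u} {v} tu≡tv = trans (sym (strictlyInverseʳ u)) (trans (cong from tu≡tv) (strictlyInverseʳ v))

    to-adj : ∀ {u v} → u ⋖ v → to u ⋖ to v ⊎ to v ⋖ to u
    to-adj u⋖v = Equivalence.to (adjPres _ _) (inj₁ u⋖v)

    -- If to reversed an edge w ⋖ v, then to v would be the parent of to w, which by
    -- induction is the image of the parent of w (w ≠ here, since to here = here);
    -- so v would be the parent of w.
    to-⋖-into : ∀ v {u} → u ⋖ v → to u ⋖ to v
    to-⋖-into = ⋖-induction (λ v → ∀ {u} → u ⋖ v → to u ⋖ to v) (λ ()) step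
      where
      step : ∀ {w v} → w ⋖ v → (∀ {x} → x ⋖ w → to x ⋖ to w) → ∀ {u} → u ⋖ v → to u ⋖ to v
      step {w} {v} w⋖v ih u⋖v with ⋖-parent-unique u⋖v w⋖v | to-adj w⋖v
      ... | refl | inj₁ tw⋖tv = tw⋖tv
      ... | refl | inj₂ tv⋖tw with root⊎parent w
      ...   | inj₁ refl        = contradiction (subst (to v ⋖_) rootPres tv⋖tw) ¬⋖here
      ...   | inj₂ (x , x⋖w)   with to-injective (⋖-parent-unique (ih x⋖w) tv⋖tw)
      ...     | refl = contradiction w⋖v (⋖-asym x⋖w)

  RLIso⇒ParentIso : ParentIso T T′
  RLIso⇒ParentIso = record
    { bij      = bij
    ; to-here  = rootPres
    ; to-label = labelPres
    ; to-⋖     = λ {u} {v} → to-⋖-into v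
    ; to-⋖⁻    = to-⋖⁻
    }
    where
    to-⋖⁻ : ∀ {u v} → to u ⋖ to v → u ⋖ v
    to-⋖⁻ {u} {v} tu⋖tv with Equivalence.from (adjPres u v) (inj₁ tu⋖tv)
    ... | inj₁ u⋖v = u⋖v
    ... | inj₂ v⋖u = contradiction tu⋖tv (⋖-asym (to-⋖-into u v⋖u))

here⋖child⇒here : ∀ {ℓ h ts i} {w : Pos (lookup ts i)} → _⋖_ {node ℓ h ts} here (child i w) → w ≡ here
here⋖child⇒here (top i) = refl

child⋖child⇒≡ : ∀ {ℓ h ts i j} {a : Pos (lookup ts i)} {b : Pos (lookup ts j)} →
                _⋖_ {node ℓ h ts} (child i a) (child j b) → i ≡ j
child⋖child⇒≡ (down i _) = refl

child⋖child⁻ : ∀ {ℓ h ts i} {a b : Pos (lookup ts i)} → _⋖_ {node ℓ h ts} (child i a) (child i b) → a ⋖ b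
child⋖child⁻ (down i a⋖b) = a⋖b

ParentIso-from-here : ∀ {T T′} (φ : ParentIso T T′) → ParentIso.from φ here ≡ here
ParentIso-from-here φ = trans (cong from (sym to-here)) (strictlyInverseʳ here)
  where open ParentIso φ

node-ParentIso : ∀ {ℓ h h′ ts ts′} (σ : Permutation (length ts) (length ts′)) →
                 (∀ i → ParentIso (lookup ts i) (lookup ts′ (σ ⟨$⟩ʳ i))) →
                 ParentIso (node ℓ h ts) (node ℓ h′ ts′)
node-ParentIso {ℓ} {h} {h′} {ts} {ts′} σ φ = record
  { bij      = mk↔ₛ′ to from to-from from-to
  ; to-here  = refl
  ; to-label = to-label
  ; to-⋖     = to-⋖
  ; to-⋖⁻    = to-⋖⁻
  }
  where
  module φ i = ParentIso (φ i)

  to : Pos (node ℓ h ts) → Pos (node ℓ h′ ts′)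
  to here        = here
  to (child i v) = child (σ ⟨$⟩ʳ i) (φ.to i v)

  -- Taking σ i ≡ j as an argument avoids transporting w along σ (σ⁻¹ j) ≡ j.
  from-child : ∀ i {j} → σ ⟨$⟩ʳ i ≡ j → Pos (lookup ts′ j) → Pos (node ℓ h ts)
  from-child i refl w = child i (φ.from i w)

  from : Pos (node ℓ h′ ts′) → Pos (node ℓ h ts)
  from here        = here
  from (child j w) = from-child (σ ⟨$⟩ˡ j) (Perm.inverseʳ σ) w

  to-from-child : ∀ i {j} (e : σ ⟨$⟩ʳ i ≡ j) w → to (from-child i e w) ≡ child j w
  to-from-child i refl w = cong (child (σ ⟨$⟩ʳ i)) (φ.strictlyInverseˡ i w)

  from-child-to : ∀ {i′ i} (e : σ ⟨$⟩ʳ i′ ≡ σ ⟨$⟩ʳ i) → i′ ≡ i →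
                  ∀ v → from-child i′ e (φ.to i v) ≡ child i v
  from-child-to refl refl v = cong (child _) (φ.strictlyInverseʳ _ v)

  to-from : ∀ w → to (from w) ≡ w
  to-from here        = refl
  to-from (child j w) = to-from-child (σ ⟨$⟩ˡ j) (Perm.inverseʳ σ) w

  from-to : ∀ v → from (to v) ≡ v
  from-to here        = refl
  from-to (child i v) = from-child-to (Perm.inverseʳ σ) (Perm.inverseˡ σ) v

  to-label : ∀ v → labelAt (to v) ≡ labelAt v
  to-label here        = refl
  to-label (child i v) = φ.to-label i v

  to-⋖ : ∀ {u v} → u ⋖ v → to u ⋖ to v
  to-⋖ (top i)      = subst (λ w → here ⋖ child (σ ⟨$⟩ʳ i) w) (sym (φ.to-here i)) (top (σ ⟨$⟩ʳ i))
  to-⋖ (down i u⋖v) = down (σ ⟨$⟩ʳ i) (φ.to-⋖ i u⋖v)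

  σ-injective : ∀ {i k} → σ ⟨$⟩ʳ i ≡ σ ⟨$⟩ʳ k → i ≡ k
  σ-injective σi≡σk = trans (sym (Perm.inverseˡ σ)) (trans (cong (σ ⟨$⟩ˡ_) σi≡σk) (Perm.inverseˡ σ))

  to-⋖⁻ : ∀ {u v} → to u ⋖ to v → u ⋖ v
  to-⋖⁻ {here}      {here}      ()
  to-⋖⁻ {here}      {child i v} tu⋖tv = subst (λ w → here ⋖ child i w) (sym v≡here) (top i)
    where
    v≡here : v ≡ here
    v≡here = begin
      v                   ≡⟨ φ.strictlyInverseʳ i v ⟨
      φ.from i (φ.to i v) ≡⟨ cong (φ.from i) (here⋖child⇒here tu⋖tv) ⟩
      φ.from i here       ≡⟨ ParentIso-from-here (φ i) ⟩
      here                ∎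
      where open ≡-Reasoning
  to-⋖⁻ {child i u} {here}      ()
  to-⋖⁻ {child i u} {child k v} tu⋖tv with σ-injective (child⋖child⇒≡ tu⋖tv)
  ... | refl = down i (φ.to-⋖⁻ i (child⋖child⁻ tu⋖tv))

≅⇒ParentIso : ∀ {T T′} → T ≅ T′ → ParentIso T T′
≅⇒ParentIso (node≅ σ sub) = node-ParentIso σ (λ i → ≅⇒ParentIso (sub i))

ParentIso-sym : ∀ {T T′} → ParentIso T T′ → ParentIso T′ T
ParentIso-sym φ = record
  { bij      = mk↔ₛ′ from to strictlyInverseʳ strictlyInverseˡ
  ; to-here  = ParentIso-from-here φ
  ; to-label = λ v → sym (trans (cong labelAt (sym (strictlyInverseˡ v))) (to-label (from v)))
  ; to-⋖     = λ {u} {v} u⋖v → to-⋖⁻ (subst₂ _⋖_ (sym (strictlyInverseˡ u)) (sym (strictlyInverseˡ v)) u⋖v)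
  ; to-⋖⁻    = λ {u} {v} fu⋖fv → subst₂ _⋖_ (strictlyInverseˡ u) (strictlyInverseˡ v) (to-⋖ fu⋖fv)
  }
  where open ParentIso φ

here⋖⇒child : ∀ {ℓ h ts} {v : Pos (node ℓ h ts)} → here ⋖ v → ∃[ i ] v ≡ child i here
here⋖⇒child (top i) = i , refl

child-here-injective : ∀ {ℓ h ts i j} → _≡_ {A = Pos (node ℓ h ts)} (child i here) (child j here) → i ≡ j
child-here-injective refl = refl

data InBranch {ℓ h ts} (i : Fin (length ts)) : Pos (node ℓ h ts) → Set where
  inBranch : (w : Pos (lookup ts i)) → InBranch i (child i w)

InBranch-⋖ : ∀ {ℓ h ts i} {u v : Pos (node ℓ h ts)} → u ⋖ v → InBranch i u → InBranch i v
InBranch-⋖ (down i _) (inBranch _) = inBranch _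

unbranch : ∀ {ℓ h ts i} {x : Pos (node ℓ h ts)} → InBranch i x → Pos (lookup ts i)
unbranch (inBranch w) = w

child-unbranch : ∀ {ℓ h ts i} {x : Pos (node ℓ h ts)} (b : InBranch i x) → child i (unbranch b) ≡ x
child-unbranch (inBranch w) = refl

unbranch-cong : ∀ {ℓ h ts i} {x y : Pos (node ℓ h ts)} (b : InBranch i x) (b′ : InBranch i y) →
                x ≡ y → unbranch b ≡ unbranch b′
unbranch-cong (inBranch w) (inBranch .w) refl = refl

module _ {ℓ h ℓ′ h′ ts ts′} (φ : ParentIso (node ℓ h ts) (node ℓ′ h′ ts′)) where
  open ParentIso φ

  child-index : Fin (length ts) → Fin (length ts′)
  child-index i = proj₁ (here⋖⇒child (subst (_⋖ to (child i here)) to-here (to-⋖ (top i))))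

  to-child-here : ∀ i → to (child i here) ≡ child (child-index i) here
  to-child-here i = proj₂ (here⋖⇒child (subst (_⋖ to (child i here)) to-here (to-⋖ (top i))))

module _ {ℓ h ℓ′ h′ ts ts′} (φ : ParentIso (node ℓ h ts) (node ℓ′ h′ ts′)) where
  open ParentIso φ
  private
    φ⁻¹ = ParentIso-sym φ

  children-perm : Permutation (length ts) (length ts′)
  children-perm = mk↔ₛ′ (child-index φ) (child-index φ⁻¹) σ∘τ τ∘σ
    where
    σ∘τ : ∀ j → child-index φ (child-index φ⁻¹ j) ≡ j
    σ∘τ j = child-here-injective (begin
      child (child-index φ (child-index φ⁻¹ j)) here  ≡⟨ to-child-here φ (child-index φ⁻¹ j) ⟨
      to (child (child-index φ⁻¹ j) here)             ≡⟨ cong to (to-child-here φ⁻¹ j) ⟨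
      to (from (child j here))                        ≡⟨ strictlyInverseˡ (child j here) ⟩
      child j here                                    ∎)
      where open ≡-Reasoning
    τ∘σ : ∀ i → child-index φ⁻¹ (child-index φ i) ≡ i
    τ∘σ i = child-here-injective (begin
      child (child-index φ⁻¹ (child-index φ i)) here  ≡⟨ to-child-here φ⁻¹ (child-index φ i) ⟨
      from (child (child-index φ i) here)             ≡⟨ cong from (to-child-here φ i) ⟨
      from (to (child i here))                        ≡⟨ strictlyInverseʳ (child i here) ⟩
      child i here                                    ∎)
      where open ≡-Reasoning

  restrict : ∀ i → ParentIso (lookup ts i) (lookup ts′ (children-perm ⟨$⟩ʳ i))
  restrict i = record
    { bij      = mk↔ₛ′ toᵢ fromᵢ toᵢ-fromᵢ fromᵢ-toᵢ
    ; to-here  = unbranch-cong (to-InBranch here) (inBranch here) (to-child-here φ i)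
    ; to-label = λ v → trans (cong labelAt (child-toᵢ v)) (to-label (child i v))
    ; to-⋖     = λ {u} {v} u⋖v →
        child⋖child⁻ (subst₂ _⋖_ (sym (child-toᵢ u)) (sym (child-toᵢ v)) (to-⋖ (down i u⋖v)))
    ; to-⋖⁻    = λ {u} {v} tu⋖tv →
        child⋖child⁻ (to-⋖⁻ (subst₂ _⋖_ (child-toᵢ u) (child-toᵢ v) (down σi tu⋖tv)))
    }
    where
    σi = child-index φ i
    to-InBranch : ∀ v → InBranch σi (to (child i v))
    to-InBranch = ⋖-induction (λ v → InBranch σi (to (child i v)))
      (subst (InBranch σi) (sym (to-child-here φ i)) (inBranch here))
      (λ u⋖v → InBranch-⋖ (to-⋖ (down i u⋖v)))
    from-InBranch : ∀ w → InBranch i (from (child σi w))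
    from-InBranch = ⋖-induction (λ w → InBranch i (from (child σi w)))
      (subst (InBranch i) (sym (trans (cong from (sym (to-child-here φ i))) (strictlyInverseʳ (child i here)))) (inBranch here))
      (λ u⋖v → InBranch-⋖ (ParentIso.to-⋖ φ⁻¹ (down σi u⋖v)))
    toᵢ : Pos (lookup ts i) → Pos (lookup ts′ σi)
    toᵢ v = unbranch (to-InBranch v)
    fromᵢ : Pos (lookup ts′ σi) → Pos (lookup ts i)
    fromᵢ w = unbranch (from-InBranch w)
    child-toᵢ : ∀ v → child σi (toᵢ v) ≡ to (child i v)
    child-toᵢ v = child-unbranch (to-InBranch v)
    child-fromᵢ : ∀ w → child i (fromᵢ w) ≡ from (child σi w)
    child-fromᵢ w = child-unbranch (from-InBranch w)
    toᵢ-fromᵢ : ∀ w → toᵢ (fromᵢ w) ≡ w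
    toᵢ-fromᵢ w = unbranch-cong (to-InBranch (fromᵢ w)) (inBranch w)
      (trans (cong to (child-fromᵢ w)) (strictlyInverseˡ (child σi w)))
    fromᵢ-toᵢ : ∀ v → fromᵢ (toᵢ v) ≡ v
    fromᵢ-toᵢ v = unbranch-cong (from-InBranch (toᵢ v)) (inBranch v)
      (trans (cong from (child-toᵢ v)) (strictlyInverseʳ (child i v)))

  root-label : ℓ′ ≡ ℓ
  root-label = trans (cong labelAt (sym to-here)) (to-label here)

mutual
  ParentIso⇒≅ : ∀ T T′ → ParentIso T T′ → T ≅ T′
  ParentIso⇒≅ (node ℓ h ts) (node ℓ′ h′ ts′) φ with root-label φ
  ParentIso⇒≅ (node ℓ h [])       (node ℓ h′ ts′) φ | refl = node≅ (children-perm φ) (λ ())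
  ParentIso⇒≅ (node ℓ h (t ∷ ts)) (node ℓ h′ ts′) φ | refl =
    node≅ (children-perm φ) (λ i → ParentIso⇒≅-lookup t ts i _ (restrict φ i))

  ParentIso⇒≅-lookup : ∀ t ts i T′ → ParentIso (lookup (t ∷ ts) i) T′ → lookup (t ∷ ts) i ≅ T′
  ParentIso⇒≅-lookup t ts       zero    = ParentIso⇒≅ t
  ParentIso⇒≅-lookup t (u ∷ ts) (suc i) = ParentIso⇒≅-lookup u ts i

mainTheorem5 : (T T' : Tree) → (C T ≈P C T') ⇔ RLIso T T'
mainTheorem5 T T′ = mk⇔
  (λ CT≈CT′ → ParentIso⇒RLIso (≅⇒ParentIso (C-injective T T′ (≈P⇒≋ CT≈CT′))))
  (λ φ → ≋⇒≈P (C-resp-≅ (ParentIso⇒≅ T T′ (RLIso⇒ParentIso φ))))
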